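{- Let $\lambda\vdash n$, $S\in\operatorname{SYT}(\lambda)$, and let $T$ be any filling of $\lambda$ using each element of $\mathbb{N}_n$ once. Then the higher Specht polynomial $F_T^S$ lies in $\mathbb{Z}[x_1,\dots,x_n]$, is homogeneous of degree $d=\operatorname{cc}(S)$, and the monomial $p_T^S$ occurs in it with coefficient $1$. Moreover, for every $g\in\tilde{C}(T)$ we have $g\cdot F_T^S=\widetilde{\operatorname{sgn}}(g)F_T^S$.
   Context: $\mathbb{N}_m=\{1,\dots,m\}$; $S_n$ acts on $\mathbb{Q}[x_1,\dots,x_n]$ by $\sigma\cdot x_i=x_{\sigma(i)}$, extended linearly to $\mathbb{Z}[S_n]$. Tableaux are in English notation; $\operatorname{SYT}(\lambda)$ is the set of standard Young tableaux of shape $\lambda$ with entries $\mathbb{N}_n$. For $S\in\operatorname{SYT}(\lambda)$ with $R_S(i),C_S(i)$ the row and column of $i$, $\operatorname{Dsi}(S)$ is the set of $i\in\mathbb{N}_{n-1}$ with $R_S(i+1)>R_S(i)$ and $C_S(i+1)\le C_S(i)$; $\operatorname{ct}(S)$ is obtained from $S$ by replacing each entry $p$ by $|\{j\in\operatorname{Dsi}(S):j<p\}|$, and $\operatorname{cc}(S)$ is the sum of its entries. For a filling $T$ of $\lambda$ by $\mathbb{N}_n$: $R(T),C(T)\le S_n$ are the row and column stabilizers; $\varepsilon_T=\sum_{\sigma\in C(T)}\sum_{\tau\in R(T)}\operatorname{sgn}(\sigma)\sigma\tau$; $p_T^S=\prod_i x_i^{h_i}$ with $h_i$ the entry of $\operatorname{ct}(S)$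 in the box where $T$ has $i$; $s_T^S=|\{\tau\in R(T):\tau p_T^S=p_T^S\}|$; and $F_T^S=\varepsilon_T p_T^S/s_T^S$. $\tilde{C}(T)$ is the subgroup of $S_n$ of permutations $\pi$ mapping the entry set of each column of $T$ onto the entry set of some column of $T$ (necessarily of the same length). For such $\pi$, let $\eta_\pi\in S_n$ send the entry in row $j$ of each column $c$ to the entry in row $j$ of the column onto which $\pi$ maps column $c$; then $\eta_\pi^{ -1}\pi\in C(T)$, and $\widetilde{\operatorname{sgn}}(\pi):=\operatorname{sgn}(\eta_\pi^{ -1}\pi)$ (a character of $\tilde{C}(T)$, trivial on the permutations $\eta_\pi$ and equal to $\operatorname{sgn}$ on $C(T)$). -}

module Defs where

open import Data.Nat as ℕ using (ℕ; zero; suc; _<_; _≥_; _≤ᵇ_; _<ᵇ_)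
open import Data.Integer as ℤ using (ℤ; +_)
open import Data.Rational as ℚ using (ℚ; 0ℚ; 1ℚ; _/_)
open import Data.Fin as Fin using (Fin; toℕ)
open import Data.Fin.Properties using () renaming (_≟_ to _≟F_)
open import Data.Vec as Vec using (Vec; []; _∷_; lookup; tabulate)
open import Data.Vec.Properties using () renaming (≡-dec to ≡-decVec)
open import Data.List as List using (List; []; _∷_; allFin; filter; map; concatMap; foldr)
open import Data.List.Relation.Unary.Linked using (Linked)
open import Data.List.Relation.Unary.All using (All)
open import Data.Maybe as Maybe using (Maybe; just; nothing)
open import Data.Bool using (Bool; true; false; _∧_; if_then_else_)
open import Data.Product using (_×_; _,_; proj₁; proj₂; ∃)
open import Data.Nat.Properties using () renaming (_≟_ to _≟ℕ_)
open import Data.Product.Properties using () renaming (≡-dec to ≡-dec×)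
open import Data.Integer.Properties using () renaming (_≟_ to _≟ℤ_)
open import Relation.Nullary using (Dec)
import Relation.Nullary.Decidable.Core
open import Relation.Binary.PropositionalEquality using (_≡_; _≢_)
open import Relation.Nullary using (¬_; does)
open import Function.Definitions using (Injective)

sumℕ : List ℕ → ℕ
sumℕ = foldr ℕ._+_ 0

sumℚ : List ℚ → ℚ
sumℚ = foldr ℚ._+_ 0ℚ

count : {A : Set} → (A → Bool) → List A → ℕ
count p xs = sumℕ (map (λ x → if p x then 1 else 0) xs)

-- q / s in ℚ for a natural s (only ever used with s ≥ 1; value 0 for s = 0)
divℚ : ℚ → ℕ → ℚ
divℚ q zero    = 0ℚ
divℚ q (suc k) = q ℚ.* (+ 1 / suc k)

-- Partitions and Young diagrams (English notation, 0-based rows/cols)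

rowLen : List ℕ → ℕ → ℕ
rowLen []       _       = 0
rowLen (x ∷ xs) zero    = x
rowLen (x ∷ xs) (suc r) = rowLen xs r

record Partition (n : ℕ) (λ′ : List ℕ) : Set where
  field
    decreasing : Linked _≥_ λ′
    positive   : All (0 <_) λ′
    total      : sumℕ λ′ ≡ n

Box : Set
Box = ℕ × ℕ   -- (row , column)

InDiagram : List ℕ → Box → Set
InDiagram λ′ (r , c) = c < rowLen λ′ r

-- Entries are Fin n
-- (entry k stands for k+1); the filling is given by the box of each entry,
-- which must be a bijection from Fin n onto the boxes of λ.
record Filling (n : ℕ) (λ′ : List ℕ) : Set where
  field
    pos    : Fin n → Box
    inj    : Injective _≡_ _≡_ pos
    inDiag : ∀ i → InDiagram λ′ (pos i)
    onto   : ∀ b → InDiagram λ′ b → ∃ λ i → pos i ≡ b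

module _ {n : ℕ} {λ′ : List ℕ} (T : Filling n λ′) where
  open Filling T

  rowOf colOf : Fin n → ℕ
  rowOf i = proj₁ (pos i)
  colOf i = proj₂ (pos i)

  entryAt : Fin n → Box → Fin n
  entryAt d b with filter (λ i → ≡-dec× _≟ℕ_ _≟ℕ_ (pos i) b) (allFin n)
  ... | []    = d
  ... | i ∷ _ = i

IsStandard : {n : ℕ} {λ′ : List ℕ} → Filling n λ′ → Set
IsStandard {n} S =
  (∀ i j → rowOf S i ≡ rowOf S j → colOf S i < colOf S j → toℕ i < toℕ j) ×
  (∀ i j → colOf S i ≡ colOf S j → rowOf S i < rowOf S j → toℕ i < toℕ j)

nextFin : {n : ℕ} → Fin n → Maybe (Fin n)
nextFin {suc zero}    Fin.zero    = nothing
nextFin {suc (suc n)} Fin.zero    = just (Fin.suc Fin.zero)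
nextFin {suc (suc n)} (Fin.suc a) = Maybe.map Fin.suc (nextFin {suc n} a)

-- a (0-based, standing for the entry a+1 of ℕ_{n-1}) lies in Dsi(S):
-- R_S(a+2) > R_S(a+1) and C_S(a+2) ≤ C_S(a+1) in 1-based entries
isDsi : {n : ℕ} {λ′ : List ℕ} → Filling n λ′ → Fin n → Bool
isDsi S a with nextFin a
... | nothing = false
... | just b  = (rowOf S a <ᵇ rowOf S b) ∧ (colOf S b ≤ᵇ colOf S a)

ctEntry : {n : ℕ} {λ′ : List ℕ} → Filling n λ′ → Fin n → ℕ
ctEntry {n} S e = count (λ a → (toℕ a <ᵇ toℕ e) ∧ isDsi S a) (allFin n)

ctBox : {n : ℕ} {λ′ : List ℕ} → Filling n λ′ → Box → ℕ
ctBox {n} S b = sumℕ (map (λ e → if does (≡-dec× _≟ℕ_ _≟ℕ_ (Filling.pos S e) b) then ctEntry S e else 0) (allFin n))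

cc : {n : ℕ} {λ′ : List ℕ} → Filling n λ′ → ℕ
cc {n} S = sumℕ (map (ctEntry S) (allFin n))

-- Polynomials in ℚ[x_1..x_n]: finite formal sums of terms coefficient·x^h,
-- h ∈ ℕ^n an exponent vector; two polynomials are equal iff all their
-- coefficients (computed by `coeff`) agree.

Monomial : ℕ → Set
Monomial n = Vec ℕ n

Poly : ℕ → Set
Poly n = List (ℚ × Monomial n)

coeff : {n : ℕ} → Poly n → Monomial n → ℚ
coeff f m = sumℚ (map (λ t → if does (≡-decVec _≟ℕ_ (proj₂ t) m) then proj₁ t else 0ℚ) f)

degree : {n : ℕ} → Monomial n → ℕ
degree m = sumℕ (Vec.toList m)

IsPerm : {n : ℕ} → (Fin n → Fin n) → Set
IsPerm σ = Injective _≡_ _≡_ σ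

-- σ · x^h = ∏ x_{σ(i)}^{h_i}: the new exponent of x_j is h_i for σ(i) = j
actMon : {n : ℕ} → (Fin n → Fin n) → Monomial n → Monomial n
actMon {n} σ h = tabulate (λ j → sumℕ (map (λ i → if does (σ i ≟F j) then lookup h i else 0) (allFin n)))

actPoly : {n : ℕ} → (Fin n → Fin n) → Poly n → Poly n
actPoly σ f = map (λ t → proj₁ t , actMon σ (proj₂ t)) f

inversions : {n : ℕ} → (Fin n → Fin n) → ℕ
inversions {n} σ = sumℕ (map (λ i → count (λ j → (toℕ i <ᵇ toℕ j) ∧ (toℕ (σ j) <ᵇ toℕ (σ i))) (allFin n)) (allFin n))

parity : ℕ → Bool
parity zero = true
parity (suc zero) = false
parity (suc (suc k)) = parity k

sgn : {n : ℕ} → (Fin n → Fin n) → ℚ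
sgn σ = if parity (inversions σ) then 1ℚ else ℚ.- 1ℚ

allVecs : {A : Set} → List A → (k : ℕ) → List (Vec A k)
allVecs xs zero    = [] ∷ []
allVecs xs (suc k) = concatMap (λ x → map (x ∷_) (allVecs xs k)) xs

allB : {A : Set} → (A → Bool) → List A → Bool
allB p = foldr (λ x b → p x ∧ b) true

isInjVec : {n : ℕ} → Vec (Fin n) n → Bool
isInjVec {n} v = allB (λ i → allB (λ j → if does (lookup v i ≟F lookup v j) then does (i ≟F j) else true) (allFin n)) (allFin n)

allPerms : (n : ℕ) → List (Fin n → Fin n)
allPerms n = map lookup (filter (λ v → Relation.Nullary.Decidable.Core.T? (isInjVec v)) (allVecs (allFin n) n))

-- composition (σ τ)(i) = σ(τ(i)), so (στ)·f = σ·(τ·f)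
_∘ₚ_ : {n : ℕ} → (Fin n → Fin n) → (Fin n → Fin n) → (Fin n → Fin n)
(σ ∘ₚ τ) i = σ (τ i)

-- (f⁻¹ ∘ g)(e): the x with f x ≡ g e (f a permutation); default e
invComp : {n : ℕ} → (Fin n → Fin n) → (Fin n → Fin n) → (Fin n → Fin n)
invComp {n} f g e with filter (λ x → f x ≟F g e) (allFin n)
... | []    = e
... | x ∷ _ = x

module _ {n : ℕ} {λ′ : List ℕ} (T : Filling n λ′) where

  inRowStab : (Fin n → Fin n) → Bool
  inRowStab σ = allB (λ i → does (rowOf T (σ i) ≟ℕ rowOf T i)) (allFin n)

  inColStab : (Fin n → Fin n) → Bool
  inColStab σ = allB (λ i → does (colOf T (σ i) ≟ℕ colOf T i)) (allFin n)

  rowStab colStab : List (Fin n → Fin n)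
  rowStab = filter (λ σ → Relation.Nullary.Decidable.Core.T? (inRowStab σ)) (allPerms n)
  colStab = filter (λ σ → Relation.Nullary.Decidable.Core.T? (inColStab σ)) (allPerms n)

  pTS : {μ : List ℕ} → Filling n μ → Monomial n
  pTS S = tabulate (λ i → ctBox S (Filling.pos T i))

  sTS : {μ : List ℕ} → Filling n μ → ℕ
  sTS S = count (λ τ → does (≡-decVec _≟ℕ_ (actMon τ (pTS S)) (pTS S))) rowStab

  εT : Poly n → Poly n
  εT f = concatMap (λ σ → concatMap (λ τ →
           map (λ t → sgn σ ℚ.* proj₁ t , actMon (σ ∘ₚ τ) (proj₂ t)) f) rowStab) colStab

  FTS : {μ : List ℕ} → Filling n μ → Poly n
  FTS S = map (λ t → divℚ (proj₁ t) (sTS S) , proj₂ t) (εT ((1ℚ , pTS S) ∷ []))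

  InCtilde : (Fin n → Fin n) → Set
  InCtilde π = IsPerm π ×
    (∀ c → ∃ (λ (e : Fin n) → colOf T e ≡ c) →
      ∃ λ c′ → (∀ e → colOf T e ≡ c → colOf T (π e) ≡ c′) ×
               (∀ f → colOf T f ≡ c′ → ∃ λ e → colOf T e ≡ c × π e ≡ f))

  eta : (Fin n → Fin n) → (Fin n → Fin n)
  eta π e = entryAt T e (rowOf T e , colOf T (π e))

  sgnTilde : (Fin n → Fin n) → ℚ
  sgnTilde π = sgn (invComp (eta π) π)

{-# OPTIONS --safe #-}

-- Write F = ε_T p / s with p = p_T^S and s = s_T^S.  The coefficient of a monomial m in F is a sum over
-- σ ∈ C(T) of sgn σ / s times the number of τ ∈ R(T) with στ·p = m.  That number is 0 or the order s of
-- the stabiliser of p in R(T), so each coefficient is a sum of signs, and only monomials of the orbit of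
-- p, all of degree cc(S), occur.  Because ct(S) increases strictly down columns, στ·p = p forces σ = 1
-- (row by row from the top, σ could only move entries down their column and so raise exponents, which
-- τ, permuting the row, cannot undo); hence p has coefficient 1.  Finally g ∈ C̃(T) factors as g = η c
-- with η ∈ R(T) normalising C(T) and c ∈ C(T), sgn c = s̃gn g; reindexing the sum over C(T) by c and by
-- conjugation with η, and the sum over R(T) by η, gives g·F = s̃gn(g) F.

module Submission where

open import Defs
open import Data.Nat using (ℕ)
open import Data.Integer using (ℤ)
open import Data.Rational using (ℚ; _/_; 0ℚ; 1ℚ; _*_)
open import Data.Fin using (Fin)
open import Data.List using (List)
open import Data.Product using (_×_; ∃)
open import Relation.Binary.PropositionalEquality using (_≡_; _≢_)

open import Algebra.Core using (Op₂)
open import Algebra.Structures using (IsCommutativeSemiring; IsCommutativeRing)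
open import Data.Bool using (Bool; true; false; _∧_; not; if_then_else_)
open import Data.Bool.Properties using (T-≡; ∧-conicalʳ)
open import Data.Empty using (⊥-elim)
open import Data.Fin as Fin using (toℕ; punchOut)
import Data.Fin.Properties as FinP
open FinP using () renaming (_≟_ to _≟F_)
open import Data.Integer as ℤ using (-[1+_])
import Data.Integer.Properties as ℤP
open import Data.List as List using ([]; _∷_; _++_; allFin; filter; map; concatMap; foldr)
import Data.List.Properties as ListP
open import Data.List.Membership.Propositional using (_∈_; find; lose)
import Data.List.Membership.Propositional.Properties as ∈P
open import Data.List.Membership.Propositional.Properties.WithK using (unique∧set⇒bag)
open import Data.List.Relation.Binary.BagAndSetEquality using (∼bag⇒↭)
open import Data.List.Relation.Binary.Permutation.Propositional using (_↭_; ↭⇒↭ₛ)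
import Data.List.Relation.Binary.Permutation.Propositional.Properties as ↭P
open import Data.List.Relation.Binary.Permutation.Setoid.Properties using (foldr-commMonoid)
import Data.List.Relation.Unary.All as All
import Data.List.Relation.Unary.All.Properties as AllP
import Data.List.Relation.Unary.Any as Any
open Any using (here; there)
open import Data.List.Relation.Unary.Linked as Linked using (Linked)
open import Data.List.Relation.Unary.Unique.Propositional using (Unique; []; _∷_)
import Data.List.Relation.Unary.Unique.Propositional.Properties as UniqueP
open import Data.Maybe using (just)
open import Data.Nat as ℕ using (zero; suc; _<_; _≤_; z≤n; s≤s)
import Data.Nat.Coprimality as Coprime
import Data.Nat.Properties as ℕP
open import Data.Product using (_,_; proj₁; proj₂)
open import Data.Product.Properties using () renaming (≡-dec to ≡-dec×)
import Data.Rational as ℚ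
open import Data.Rational using (mkℚ)
import Data.Rational.Properties as ℚP
open import Data.Sum using (_⊎_; inj₁; inj₂)
open import Data.Vec as Vec using (Vec; []; _∷_; lookup; tabulate)
import Data.Vec.Properties as VecP
open import Data.Vec.Relation.Binary.Pointwise.Extensional using (ext; Pointwise-≡⇒≡)
open import Function using (id; _∘_; case_of_; _⇔_; mk⇔; Equivalence)
open import Relation.Binary.Definitions using (tri<; tri≈; tri>)
open import Relation.Binary.PropositionalEquality
  using (refl; sym; trans; cong; cong₂; subst; subst₂; _≗_; setoid; module ≡-Reasoning)
open import Relation.Nullary using (Dec; yes; no; ¬_; does)
open import Relation.Nullary.Decidable using (dec-true; dec-false; does-⇔; T?)
open import Relation.Unary using (Decidable)

does⇒witness : ∀ {P : Set} (P? : Dec P) → does P? ≡ true → P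
does⇒witness (yes p) _ = p

∘ₚ-isPerm : ∀ {n} {σ τ : Fin n → Fin n} → IsPerm σ → IsPerm τ → IsPerm (σ ∘ₚ τ)
∘ₚ-isPerm σ-perm τ-perm = τ-perm ∘ σ-perm

isPerm⇒surjective : ∀ {n} {π : Fin n → Fin n} → IsPerm π → ∀ y → ∃ λ x → π x ≡ y
isPerm⇒surjective {n} {π} π-perm y with FinP.any? (λ x → π x ≟F y)
... | yes hit = hit
isPerm⇒surjective {suc n} {π} π-perm y | no miss =
  ⊥-elim (ℕP.<-irrefl refl (FinP.injective⇒≤ squeeze-injective))
  where
  avoids : ∀ x → y ≢ π x
  avoids x eq = miss (x , sym eq)
  squeeze : Fin (suc n) → Fin n
  squeeze x = punchOut (avoids x)
  squeeze-injective : ∀ {x x′} → squeeze x ≡ squeeze x′ → x ≡ x′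
  squeeze-injective eq = π-perm (FinP.punchOut-injective (avoids _) (avoids _) eq)

unique∧sameElements⇒↭ : {A : Set} {xs ys : List A} → Unique xs → Unique ys →
  (∀ {x} → x ∈ xs → x ∈ ys) → (∀ {x} → x ∈ ys → x ∈ xs) → xs ↭ ys
unique∧sameElements⇒↭ xs! ys! to from = ∼bag⇒↭ (unique∧set⇒bag xs! ys! (mk⇔ to from))

map-unique-on : {A B : Set} (f : A → B) {xs : List A} →
  (∀ {x y} → x ∈ xs → y ∈ xs → f x ≡ f y → x ≡ y) → Unique xs → Unique (map f xs)
map-unique-on f f-inj []          = []
map-unique-on f f-inj (x∉xs ∷ xs!) =
  AllP.map⁺ (All.tabulate λ y∈ fx≡fy → All.lookup x∉xs y∈ (f-inj (here refl) (there y∈) fx≡fy)) ∷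
  map-unique-on f (λ x∈ y∈ → f-inj (there x∈) (there y∈)) xs!

map-allFin-↭ : ∀ {n} {π : Fin n → Fin n} → IsPerm π → map π (allFin n) ↭ allFin n
map-allFin-↭ {n} {π} π-perm = unique∧sameElements⇒↭
  (UniqueP.map⁺ π-perm (UniqueP.allFin⁺ n)) (UniqueP.allFin⁺ n) (λ _ → ∈P.∈-allFin _) hit
  where
  hit : ∀ {y} → y ∈ allFin n → y ∈ map π (allFin n)
  hit {y} _ with isPerm⇒surjective π-perm y
  ... | x , refl = ∈P.∈-map⁺ π (∈P.∈-allFin x)

invComp-correct : ∀ {n} (f g : Fin n → Fin n) e → (∃ λ x → f x ≡ g e) → f (invComp f g e) ≡ g e
invComp-correct {n} f g e (x , fx≡ge) with filter (λ x → f x ≟F g e) (allFin n) in eq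
... | [] with () ← subst (x ∈_) eq (∈P.∈-filter⁺ (λ x → f x ≟F g e) (∈P.∈-allFin x) fx≡ge)
... | y ∷ _ = proj₂ (∈P.∈-filter⁻ (λ x → f x ≟F g e) {xs = allFin n} (subst (y ∈_) (sym eq) (here refl)))

inv : ∀ {n} → (Fin n → Fin n) → Fin n → Fin n
inv π = invComp π id

module _ {n} {π : Fin n → Fin n} (π-perm : IsPerm π) where

  inv-inverseʳ : ∀ y → π (inv π y) ≡ y
  inv-inverseʳ y = invComp-correct π id y (isPerm⇒surjective π-perm y)

  inv-inverseˡ : ∀ x → inv π (π x) ≡ x
  inv-inverseˡ x = π-perm (inv-inverseʳ (π x))

  inv-isPerm : IsPerm (inv π)
  inv-isPerm {x} {y} eq = trans (sym (inv-inverseʳ x)) (trans (cong π eq) (inv-inverseʳ y))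

module FiniteSum {A : Set} {_+_ _*_ : Op₂ A} {0# 1# : A}
                 (isCommutativeSemiring : IsCommutativeSemiring _≡_ _+_ _*_ 0# 1#) where

  open IsCommutativeSemiring isCommutativeSemiring
    using (+-assoc; +-comm; +-identityˡ; +-identityʳ; zeroʳ; distribˡ; +-isCommutativeMonoid)

  private variable B C : Set

  -- Instantiated at ℕ and ℚ, coeff, count, cc, inversions and sTS from Defs are definitionally such sums.
  ∑ : List B → (B → A) → A
  ∑ xs f = foldr _+_ 0# (map f xs)

  ∑-cong : (xs : List B) {f g : B → A} → (∀ x → x ∈ xs → f x ≡ g x) → ∑ xs f ≡ ∑ xs g
  ∑-cong []       f≗g = refl
  ∑-cong (x ∷ xs) f≗g = cong₂ _+_ (f≗g x (here refl)) (∑-cong xs (λ y y∈ → f≗g y (there y∈)))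

  ∑-++ : (xs ys : List B) (f : B → A) → ∑ (xs ++ ys) f ≡ ∑ xs f + ∑ ys f
  ∑-++ []       ys f = sym (+-identityˡ _)
  ∑-++ (x ∷ xs) ys f = trans (cong (f x +_) (∑-++ xs ys f)) (sym (+-assoc (f x) _ _))

  ∑-map : (xs : List C) (g : C → B) (f : B → A) → ∑ (map g xs) f ≡ ∑ xs (f ∘ g)
  ∑-map []       g f = refl
  ∑-map (x ∷ xs) g f = cong (f (g x) +_) (∑-map xs g f)

  ∑-concatMap : (xs : List C) (k : C → List B) (f : B → A) →
    ∑ (concatMap k xs) f ≡ ∑ xs (λ x → ∑ (k x) f)
  ∑-concatMap []       k f = refl
  ∑-concatMap (x ∷ xs) k f = trans (∑-++ (k x) _ f) (cong (∑ (k x) f +_) (∑-concatMap xs k f))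

  ∑-filter : {P : B → Set} (P? : Decidable P) (xs : List B) (f : B → A) →
    ∑ (filter P? xs) f ≡ ∑ xs (λ x → if does (P? x) then f x else 0#)
  ∑-filter P? []       f = refl
  ∑-filter P? (x ∷ xs) f with does (P? x)
  ... | true  = cong (f x +_) (∑-filter P? xs f)
  ... | false = trans (∑-filter P? xs f) (sym (+-identityˡ _))

  ∑-zero : (xs : List B) → ∑ xs (λ _ → 0#) ≡ 0#
  ∑-zero []       = refl
  ∑-zero (x ∷ xs) = trans (+-identityˡ _) (∑-zero xs)

  ∑-+ : (xs : List B) (f g : B → A) → ∑ xs (λ x → f x + g x) ≡ ∑ xs f + ∑ xs g
  ∑-+ []       f g = sym (+-identityˡ 0#)
  ∑-+ (x ∷ xs) f g = begin
    (f x + g x) + ∑ xs (λ x → f x + g x)  ≡⟨ cong ((f x + g x) +_) (∑-+ xs f g) ⟩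
    (f x + g x) + (∑ xs f + ∑ xs g)       ≡⟨ +-assoc (f x) (g x) _ ⟩
    f x + (g x + (∑ xs f + ∑ xs g))       ≡⟨ cong (f x +_) (sym (+-assoc (g x) _ _)) ⟩
    f x + ((g x + ∑ xs f) + ∑ xs g)       ≡⟨ cong (λ z → f x + (z + ∑ xs g)) (+-comm (g x) _) ⟩
    f x + ((∑ xs f + g x) + ∑ xs g)       ≡⟨ cong (f x +_) (+-assoc (∑ xs f) (g x) _) ⟩
    f x + (∑ xs f + (g x + ∑ xs g))       ≡⟨ sym (+-assoc (f x) _ _) ⟩
    (f x + ∑ xs f) + (g x + ∑ xs g)       ∎
    where open ≡-Reasoning

  ∑-*ˡ : (xs : List B) (c : A) (f : B → A) → ∑ xs (λ x → c * f x) ≡ c * ∑ xs f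
  ∑-*ˡ []       c f = sym (zeroʳ c)
  ∑-*ˡ (x ∷ xs) c f = trans (cong ((c * f x) +_) (∑-*ˡ xs c f)) (sym (distribˡ c (f x) _))

  ∑-↭ : {xs ys : List B} (f : B → A) → xs ↭ ys → ∑ xs f ≡ ∑ ys f
  ∑-↭ f p = foldr-commMonoid (setoid A) +-isCommutativeMonoid (↭⇒↭ₛ (↭P.map⁺ f p))

  ∑-swap : (xs : List B) (ys : List C) (f : B → C → A) →
    ∑ xs (λ x → ∑ ys (f x)) ≡ ∑ ys (λ y → ∑ xs (λ x → f x y))
  ∑-swap []       ys f = sym (∑-zero ys)
  ∑-swap (x ∷ xs) ys f = trans (cong (∑ ys (f x) +_) (∑-swap xs ys f)) (sym (∑-+ ys (f x) _))

  ∑-indicator : (xs : List B) {a : B} (b : B → Bool) (h : B → A) → Unique xs → a ∈ xs →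
    (∀ y → b y ≡ true → y ≡ a) → b a ≡ true → ∑ xs (λ y → if b y then h y else 0#) ≡ h a
  ∑-indicator (x ∷ xs) b h (x∉xs ∷ xs!) a∈ only-a ba with b x in bx
  ... | true with refl ← only-a x bx =
    trans (cong (h x +_) (trans (∑-cong xs vanish) (∑-zero xs))) (+-identityʳ _)
    where
    vanish : ∀ y → y ∈ xs → (if b y then h y else 0#) ≡ 0#
    vanish y y∈ with b y in by
    ... | true  = ⊥-elim (All.lookup x∉xs y∈ (sym (only-a y by)))
    ... | false = refl
  ∑-indicator (x ∷ xs) b h (_ ∷ xs!) (here refl) only-a ba | false with () ← trans (sym bx) ba
  ∑-indicator (x ∷ xs) b h (_ ∷ xs!) (there a∈) only-a ba | false =
    trans (+-identityˡ _) (∑-indicator xs b h xs! a∈ only-a ba)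

  ∑-permuteFin : ∀ {n} {π : Fin n → Fin n} → IsPerm π → (h : Fin n → A) →
    ∑ (allFin n) (h ∘ π) ≡ ∑ (allFin n) h
  ∑-permuteFin {n} {π} π-perm h = trans (sym (∑-map (allFin n) π h)) (∑-↭ h (map-allFin-↭ π-perm))

module Σℚ = FiniteSum (IsCommutativeRing.isCommutativeSemiring ℚP.+-*-isCommutativeRing)

module Σℕ where
  open FiniteSum ℕP.+-*-isCommutativeSemiring public

  private variable B : Set

  ∑-mono-≤ : (xs : List B) {f g : B → ℕ} → (∀ x → x ∈ xs → f x ≤ g x) → ∑ xs f ≤ ∑ xs g
  ∑-mono-≤ []       f≤g = z≤n
  ∑-mono-≤ (x ∷ xs) f≤g = ℕP.+-mono-≤ (f≤g x (here refl)) (∑-mono-≤ xs (λ y y∈ → f≤g y (there y∈)))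

  ∑-mono-< : (xs : List B) {f g : B → ℕ} → (∀ x → x ∈ xs → f x ≤ g x) →
    ∀ {a} → a ∈ xs → f a < g a → ∑ xs f < ∑ xs g
  ∑-mono-< (x ∷ xs) f≤g (here refl) fa<ga =
    ℕP.+-mono-<-≤ fa<ga (∑-mono-≤ xs (λ y y∈ → f≤g y (there y∈)))
  ∑-mono-< (x ∷ xs) f≤g (there a∈) fa<ga =
    ℕP.+-mono-≤-< (f≤g x (here refl)) (∑-mono-< xs (λ y y∈ → f≤g y (there y∈)) a∈ fa<ga)

  ∑-mono-≤-equality : (xs : List B) {f g : B → ℕ} → (∀ x → x ∈ xs → f x ≤ g x) →
    ∑ xs f ≡ ∑ xs g → ∀ x → x ∈ xs → f x ≡ g x
  ∑-mono-≤-equality xs f≤g ∑f≡∑g x x∈ with ℕP.m≤n⇒m<n∨m≡n (f≤g x x∈)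
  ... | inj₂ fx≡gx = fx≡gx
  ... | inj₁ fx<gx = ⊥-elim (ℕP.<-irrefl ∑f≡∑g (∑-mono-< xs f≤g x∈ fx<gx))

  term≤∑ : (xs : List B) (f : B → ℕ) {x : B} → x ∈ xs → f x ≤ ∑ xs f
  term≤∑ (y ∷ xs) f (here refl) = ℕP.m≤m+n (f y) _
  term≤∑ (y ∷ xs) f (there x∈)  = ℕP.≤-trans (term≤∑ xs f x∈) (ℕP.m≤n+m _ (f y))

perm-nonincreasing⇒invariant : ∀ {n} {τ : Fin n → Fin n} → IsPerm τ → (f : Fin n → ℕ) →
  (∀ k → f (τ k) ≤ f k) → ∀ k → f (τ k) ≡ f k
perm-nonincreasing⇒invariant {n} τ-perm f lowers k =
  Σℕ.∑-mono-≤-equality (allFin n) (λ k _ → lowers k) (Σℕ.∑-permuteFin τ-perm f) k (∈P.∈-allFin k)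

≡-if-does : ∀ {A : Set} {P : Set} (P? : Dec P) {x y z : A} → (P → z ≡ x) → (¬ P → z ≡ y) →
  z ≡ (if does P? then x else y)
≡-if-does (yes p) if-p _     = if-p p
≡-if-does (no ¬p) _    if-¬p = if-¬p ¬p

if-then-0-mono : ∀ b {x y : ℕ} → (b ≡ true → x ≤ y) → (if b then x else 0) ≤ (if b then y else 0)
if-then-0-mono true  x≤y = x≤y refl
if-then-0-mono false _   = z≤n

if-true-≡ : ∀ {b} {x y : ℕ} → b ≡ true → (if b then x else 0) ≡ (if b then y else 0) → x ≡ y
if-true-≡ refl eq = eq

lookup-ext : ∀ {A : Set} {n} {u v : Vec A n} → (∀ i → lookup u i ≡ lookup v i) → u ≡ v
lookup-ext u≗v = Pointwise-≡⇒≡ (ext u≗v)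

toList≡tabulate-lookup : ∀ {A : Set} {n} (v : Vec A n) → Vec.toList v ≡ List.tabulate (lookup v)
toList≡tabulate-lookup []      = refl
toList≡tabulate-lookup (x ∷ v) = cong (x ∷_) (toList≡tabulate-lookup v)

degree-∑ : ∀ {n} (m : Monomial n) → degree m ≡ Σℕ.∑ (allFin n) (lookup m)
degree-∑ m = cong sumℕ (trans (toList≡tabulate-lookup m) (sym (ListP.map-tabulate id (lookup m))))

module _ {n} {π : Fin n → Fin n} (π-perm : IsPerm π) where

  lookup-actMon : (h : Monomial n) (k : Fin n) → lookup (actMon π h) (π k) ≡ lookup h k
  lookup-actMon h k = trans (VecP.lookup∘tabulate _ (π k))
    (Σℕ.∑-indicator (allFin n) (λ i → does (π i ≟F π k)) (lookup h) (UniqueP.allFin⁺ n)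
      (∈P.∈-allFin k) (λ i hit → π-perm (does⇒witness (π i ≟F π k) hit)) (dec-true (π k ≟F π k) refl))

  actMon-injective : ∀ {h h′ : Monomial n} → actMon π h ≡ actMon π h′ → h ≡ h′
  actMon-injective {h} {h′} eq = lookup-ext λ k →
    trans (sym (lookup-actMon h k)) (trans (cong (λ v → lookup v (π k)) eq) (lookup-actMon h′ k))

  actMon-unique : (h m : Monomial n) → (∀ k → lookup m (π k) ≡ lookup h k) → actMon π h ≡ m
  actMon-unique h m m∘π≗h = lookup-ext λ j → case isPerm⇒surjective π-perm j of λ where
    (k , refl) → trans (lookup-actMon h k) (sym (m∘π≗h k))

  degree-actMon : (h : Monomial n) → degree (actMon π h) ≡ degree h
  degree-actMon h = begin
    degree (actMon π h)                     ≡⟨ degree-∑ (actMon π h) ⟩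
    Σℕ.∑ (allFin n) (lookup (actMon π h))   ≡⟨ Σℕ.∑-permuteFin π-perm (lookup (actMon π h)) ⟨
    Σℕ.∑ (allFin n) (lookup (actMon π h) ∘ π) ≡⟨ Σℕ.∑-cong (allFin n) (λ k _ → lookup-actMon h k) ⟩
    Σℕ.∑ (allFin n) (lookup h)              ≡⟨ degree-∑ h ⟨
    degree h                                ∎
    where open ≡-Reasoning

actMon-∘ : ∀ {n} {σ τ : Fin n → Fin n} → IsPerm σ → IsPerm τ → (h : Monomial n) →
  actMon (σ ∘ₚ τ) h ≡ actMon σ (actMon τ h)
actMon-∘ {σ = σ} {τ} σ-perm τ-perm h = actMon-unique (∘ₚ-isPerm σ-perm τ-perm) h _
  (λ k → trans (lookup-actMon σ-perm (actMon τ h) (τ k)) (lookup-actMon τ-perm h k))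

actMon-cong : ∀ {n} {σ σ′ : Fin n → Fin n} → σ ≗ σ′ → (h : Monomial n) → actMon σ h ≡ actMon σ′ h
actMon-cong {n} σ≗σ′ h = VecP.tabulate-cong λ j →
  Σℕ.∑-cong (allFin n) (λ i _ → cong (λ z → if does (z ≟F j) then lookup h i else 0) (σ≗σ′ i))

actMon-≗id : ∀ {n} {π : Fin n → Fin n} → π ≗ id → (h : Monomial n) → actMon π h ≡ h
actMon-≗id π≗id h = trans (actMon-cong π≗id h) (actMon-unique id h h (λ _ → refl))

isPerm-lookup-tabulate : ∀ {n} {π : Fin n → Fin n} → IsPerm π → IsPerm (lookup (tabulate π))
isPerm-lookup-tabulate {π = π} π-perm {i} {j} eq =
  π-perm (trans (sym (VecP.lookup∘tabulate π i)) (trans eq (VecP.lookup∘tabulate π j)))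

-- Membership in allPerms is equality of functions, and its elements all have the form lookup v.
idₚ : ∀ {n} → Fin n → Fin n
idₚ {n} = lookup (tabulate id)

idₚ-id : ∀ {n} → idₚ {n} ≗ id
idₚ-id = VecP.lookup∘tabulate id

idₚ-isPerm : ∀ {n} → IsPerm (idₚ {n})
idₚ-isPerm = isPerm-lookup-tabulate id

module _ {A : Set} where

  allVecs≡cartesianProduct : (xs : List A) (k : ℕ) →
    allVecs xs (suc k) ≡ List.cartesianProductWith _∷_ xs (allVecs xs k)
  allVecs≡cartesianProduct xs k = go xs
    where
    go : ∀ ys → concatMap (λ y → map (y ∷_) (allVecs xs k)) ys ≡ List.cartesianProductWith _∷_ ys (allVecs xs k)
    go []       = refl
    go (y ∷ ys) = cong (map (y ∷_) (allVecs xs k) ++_) (go ys)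

  ∈-allVecs : (xs : List A) {k : ℕ} (v : Vec A k) → (∀ i → lookup v i ∈ xs) → v ∈ allVecs xs k
  ∈-allVecs xs []      _    = here refl
  ∈-allVecs xs (x ∷ v) v⊆xs = subst (x ∷ v ∈_) (sym (allVecs≡cartesianProduct xs _))
    (∈P.∈-cartesianProductWith⁺ _∷_ (v⊆xs Fin.zero) (∈-allVecs xs v (v⊆xs ∘ Fin.suc)))

  allVecs-unique : (xs : List A) (k : ℕ) → Unique xs → Unique (allVecs xs k)
  allVecs-unique xs zero    _   = All.[] ∷ []
  allVecs-unique xs (suc k) xs! = subst Unique (sym (allVecs≡cartesianProduct xs k))
    (UniqueP.cartesianProductWith⁺ _∷_ VecP.∷-injective xs! (allVecs-unique xs k xs!))

  allB-sound : (p : A → Bool) (xs : List A) → allB p xs ≡ true → ∀ {x} → x ∈ xs → p x ≡ true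
  allB-sound p (y ∷ xs) all-p x∈ with p y in py
  allB-sound p (y ∷ xs) all-p (here refl) | true = py
  allB-sound p (y ∷ xs) all-p (there x∈)  | true = allB-sound p xs all-p x∈

  allB-complete : (p : A → Bool) (xs : List A) → (∀ {x} → x ∈ xs → p x ≡ true) → allB p xs ≡ true
  allB-complete p []       _   = refl
  allB-complete p (y ∷ xs) p-xs rewrite p-xs (here refl) = allB-complete p xs (p-xs ∘ there)

isInjVec≡true⇔isPerm : ∀ {n} (v : Vec (Fin n) n) → isInjVec v ≡ true ⇔ IsPerm (lookup v)
isInjVec≡true⇔isPerm {n} v = mk⇔ sound complete
  where
  test : Fin n → Fin n → Bool
  test i j = if does (lookup v i ≟F lookup v j) then does (i ≟F j) else true

  sound : isInjVec v ≡ true → IsPerm (lookup v)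
  sound all-ok {i} {j} vi≡vj = does⇒witness (i ≟F j)
    (subst (λ b → (if b then does (i ≟F j) else true) ≡ true) (dec-true (lookup v i ≟F lookup v j) vi≡vj)
      (allB-sound (test i) (allFin n) (allB-sound _ (allFin n) all-ok (∈P.∈-allFin i)) (∈P.∈-allFin j)))

  complete : IsPerm (lookup v) → isInjVec v ≡ true
  complete v-inj = allB-complete _ (allFin n) λ {i} _ → allB-complete (test i) (allFin n) λ {j} _ → ok i j
    where
    ok : ∀ i j → test i j ≡ true
    ok i j with lookup v i ≟F lookup v j
    ... | yes vi≡vj = dec-true (i ≟F j) (v-inj vi≡vj)
    ... | no  _     = refl

injVecs : (n : ℕ) → List (Vec (Fin n) n)
injVecs n = filter (λ v → T? (isInjVec v)) (allVecs (allFin n) n)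

injVecs-unique : ∀ n → Unique (injVecs n)
injVecs-unique n = UniqueP.filter⁺ _ (allVecs-unique (allFin n) n (UniqueP.allFin⁺ n))

∈-injVecs⇒isPerm : ∀ {n} {v : Vec (Fin n) n} → v ∈ injVecs n → IsPerm (lookup v)
∈-injVecs⇒isPerm {n} {v} v∈ = Equivalence.to (isInjVec≡true⇔isPerm v)
  (Equivalence.to T-≡ (proj₂ (∈P.∈-filter⁻ (λ v → T? (isInjVec v)) {xs = allVecs (allFin n) n} v∈)))

isPerm⇒∈-injVecs : ∀ {n} {v : Vec (Fin n) n} → IsPerm (lookup v) → v ∈ injVecs n
isPerm⇒∈-injVecs {n} {v} v-perm = ∈P.∈-filter⁺ (λ v → T? (isInjVec v))
  (∈-allVecs (allFin n) v (λ _ → ∈P.∈-allFin _))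
  (Equivalence.from T-≡ (Equivalence.from (isInjVec≡true⇔isPerm v) v-perm))

∈-allPerms⇒isPerm : ∀ {n} {π : Fin n → Fin n} → π ∈ allPerms n → IsPerm π
∈-allPerms⇒isPerm π∈ with ∈P.∈-map⁻ lookup π∈
... | v , v∈ , refl = ∈-injVecs⇒isPerm v∈

idₚ∈allPerms : ∀ {n} → idₚ {n} ∈ allPerms n
idₚ∈allPerms = ∈P.∈-map⁺ lookup (isPerm⇒∈-injVecs {v = tabulate id} idₚ-isPerm)

Respects≗ : ∀ {n} {A : Set} → ((Fin n → Fin n) → A) → Set
Respects≗ f = ∀ {π π′} → π ≗ π′ → f π ≡ f π′

record PermBijection (n : ℕ) : Set where
  field
    to from     : (Fin n → Fin n) → Fin n → Fin n
    to-isPerm   : ∀ {π} → IsPerm π → IsPerm (to π)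
    from-isPerm : ∀ {π} → IsPerm π → IsPerm (from π)
    to-cong     : ∀ {π π′} → π ≗ π′ → to π ≗ to π′
    from-cong   : ∀ {π π′} → π ≗ π′ → from π ≗ from π′
    to∘from     : ∀ {π} → IsPerm π → to (from π) ≗ π
    from∘to     : ∀ {π} → IsPerm π → from (to π) ≗ π

module _ {n} (B : PermBijection n) where
  open PermBijection B

  transport : Vec (Fin n) n → Vec (Fin n) n
  transport v = tabulate (to (lookup v))

  lookup-transport : ∀ v → lookup (transport v) ≗ to (lookup v)
  lookup-transport v = VecP.lookup∘tabulate (to (lookup v))

  map-transport-↭ : map transport (injVecs n) ↭ injVecs n
  map-transport-↭ = unique∧sameElements⇒↭
    (map-unique-on transport injective-on (injVecs-unique n)) (injVecs-unique n) into onto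
    where
    injective-on : ∀ {v w} → v ∈ injVecs n → w ∈ injVecs n → transport v ≡ transport w → v ≡ w
    injective-on {v} {w} v∈ w∈ tv≡tw = lookup-ext λ i → begin
      lookup v i                 ≡⟨ from∘to (∈-injVecs⇒isPerm v∈) i ⟨
      from (to (lookup v)) i     ≡⟨ from-cong to-v≗to-w i ⟩
      from (to (lookup w)) i     ≡⟨ from∘to (∈-injVecs⇒isPerm w∈) i ⟩
      lookup w i                 ∎
      where
      open ≡-Reasoning
      to-v≗to-w : to (lookup v) ≗ to (lookup w)
      to-v≗to-w j = trans (sym (lookup-transport v j))
                          (trans (cong (λ u → lookup u j) tv≡tw) (lookup-transport w j))

    into : ∀ {u} → u ∈ map transport (injVecs n) → u ∈ injVecs n
    into u∈ with ∈P.∈-map⁻ transport u∈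
    ... | v , v∈ , refl = isPerm⇒∈-injVecs (isPerm-lookup-tabulate (to-isPerm (∈-injVecs⇒isPerm v∈)))

    onto : ∀ {u} → u ∈ injVecs n → u ∈ map transport (injVecs n)
    onto {u} u∈ = subst (_∈ map transport (injVecs n)) tv≡u (∈P.∈-map⁺ transport v∈)
      where
      u-perm : IsPerm (lookup u)
      u-perm = ∈-injVecs⇒isPerm u∈
      v : Vec (Fin n) n
      v = tabulate (from (lookup u))
      v∈ : v ∈ injVecs n
      v∈ = isPerm⇒∈-injVecs (isPerm-lookup-tabulate (from-isPerm u-perm))
      tv≡u : transport v ≡ u
      tv≡u = lookup-ext λ i → trans (lookup-transport v i)
        (trans (to-cong (VecP.lookup∘tabulate (from (lookup u))) i) (to∘from u-perm i))

  ∑-allPerms-reindex : (f : (Fin n → Fin n) → ℚ) → Respects≗ f →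
    Σℚ.∑ (allPerms n) (f ∘ to) ≡ Σℚ.∑ (allPerms n) f
  ∑-allPerms-reindex f f-resp = begin
    ∑ (allPerms n) (f ∘ to)                     ≡⟨ ∑-map (injVecs n) lookup (f ∘ to) ⟩
    ∑ (injVecs n) (f ∘ to ∘ lookup)             ≡⟨ ∑-cong (injVecs n) (λ v _ → f-resp (sym ∘ lookup-transport v)) ⟩
    ∑ (injVecs n) (f ∘ lookup ∘ transport)      ≡⟨ ∑-map (injVecs n) transport (f ∘ lookup) ⟨
    ∑ (map transport (injVecs n)) (f ∘ lookup)  ≡⟨ ∑-↭ (f ∘ lookup) map-transport-↭ ⟩
    ∑ (injVecs n) (f ∘ lookup)                  ≡⟨ ∑-map (injVecs n) lookup f ⟨
    ∑ (allPerms n) f                            ∎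
    where
    open ≡-Reasoning
    open Σℚ

∑-allPerms-indicator-idₚ : ∀ {n} (b : (Fin n → Fin n) → Bool) → (∀ π → b π ≡ true → π ≗ id) →
  b idₚ ≡ true → Σℚ.∑ (allPerms n) (λ π → if b π then 1ℚ else 0ℚ) ≡ 1ℚ
∑-allPerms-indicator-idₚ {n} b only-id b-id =
  trans (Σℚ.∑-map (injVecs n) lookup _)
    (Σℚ.∑-indicator (injVecs n) (b ∘ lookup) (λ _ → 1ℚ) (injVecs-unique n)
      (isPerm⇒∈-injVecs {v = tabulate id} idₚ-isPerm)
      (λ v bv → lookup-ext λ i → trans (only-id (lookup v) bv i) (sym (idₚ-id i))) b-id)

leftMultiplication : ∀ {n} {ρ : Fin n → Fin n} → IsPerm ρ → PermBijection n
leftMultiplication {ρ = ρ} ρ-perm = record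
  { to          = ρ ∘ₚ_
  ; from        = inv ρ ∘ₚ_
  ; to-isPerm   = ∘ₚ-isPerm ρ-perm
  ; from-isPerm = ∘ₚ-isPerm (inv-isPerm ρ-perm)
  ; to-cong     = λ π≗π′ i → cong ρ (π≗π′ i)
  ; from-cong   = λ π≗π′ i → cong (inv ρ) (π≗π′ i)
  ; to∘from     = λ {π} _ i → inv-inverseʳ ρ-perm (π i)
  ; from∘to     = λ {π} _ i → inv-inverseˡ ρ-perm (π i)
  }

conjugation : ∀ {n} {ρ : Fin n → Fin n} → IsPerm ρ → PermBijection n
conjugation {ρ = ρ} ρ-perm = record
  { to          = λ π → ρ ∘ₚ (π ∘ₚ inv ρ)
  ; from        = λ π → inv ρ ∘ₚ (π ∘ₚ ρ)
  ; to-isPerm   = λ π-perm → ∘ₚ-isPerm ρ-perm (∘ₚ-isPerm π-perm (inv-isPerm ρ-perm))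
  ; from-isPerm = λ π-perm → ∘ₚ-isPerm (inv-isPerm ρ-perm) (∘ₚ-isPerm π-perm ρ-perm)
  ; to-cong     = λ π≗π′ i → cong ρ (π≗π′ (inv ρ i))
  ; from-cong   = λ π≗π′ i → cong (inv ρ) (π≗π′ (ρ i))
  ; to∘from     = λ {π} _ i → trans (inv-inverseʳ ρ-perm _) (cong π (inv-inverseʳ ρ-perm i))
  ; from∘to     = λ {π} _ i → trans (inv-inverseˡ ρ-perm _) (cong π (inv-inverseˡ ρ-perm i))
  }

-- The sign is multiplicative

[_]ᴺ : Bool → ℕ
[ b ]ᴺ = if b then 1 else 0

_<ᶠ_ : ∀ {n} → Fin n → Fin n → Bool
i <ᶠ j = toℕ i ℕ.<ᵇ toℕ j

<ᶠ-irrefl : ∀ {n} (i : Fin n) → (i <ᶠ i) ≡ false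
<ᶠ-irrefl i = dec-false (toℕ i ℕP.<? toℕ i) (ℕP.<-irrefl refl)

<ᶠ-asym : ∀ {n} (i j : Fin n) → (i <ᶠ j) ≡ true → (j <ᶠ i) ≡ false
<ᶠ-asym i j i<j = dec-false (toℕ j ℕP.<? toℕ i) (ℕP.<-asym (does⇒witness (toℕ i ℕP.<? toℕ j) i<j))

<ᶠ-connex : ∀ {n} (i j : Fin n) → i ≢ j → (i <ᶠ j) ≡ not (j <ᶠ i)
<ᶠ-connex i j i≢j with ℕP.<-cmp (toℕ i) (toℕ j)
... | tri< i<j _ j≮i = trans (dec-true (_ ℕP.<? _) i<j) (cong not (sym (dec-false (_ ℕP.<? _) j≮i)))
... | tri≈ _ i≡j _   = ⊥-elim (i≢j (FinP.toℕ-injective i≡j))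
... | tri> i≮j _ j<i = trans (dec-false (_ ℕP.<? _) i≮j) (cong not (sym (dec-true (_ ℕP.<? _) j<i)))

<ᶠ⇒≢ : ∀ {n} {i j : Fin n} → (i <ᶠ j) ≡ true → i ≢ j
<ᶠ⇒≢ {i = i} i<j refl with () ← trans (sym i<j) (<ᶠ-irrefl i)

module Inversions {n} {σ : Fin n → Fin n} (σ-perm : IsPerm σ) where
  open Σℕ

  ∑² : (Fin n → Fin n → ℕ) → ℕ
  ∑² f = ∑ (allFin n) (λ i → ∑ (allFin n) (f i))

  ∑²-cong : ∀ {f g} → (∀ i j → f i j ≡ g i j) → ∑² f ≡ ∑² g
  ∑²-cong f≗g = ∑-cong (allFin n) (λ i _ → ∑-cong (allFin n) (λ j _ → f≗g i j))

  ∑²-+ : ∀ f g → ∑² (λ i j → f i j ℕ.+ g i j) ≡ ∑² f ℕ.+ ∑² g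
  ∑²-+ f g = trans (∑-cong (allFin n) (λ i _ → ∑-+ (allFin n) (f i) (g i))) (∑-+ (allFin n) _ _)

  ∑²-*ˡ : ∀ c f → ∑² (λ i j → c ℕ.* f i j) ≡ c ℕ.* ∑² f
  ∑²-*ˡ c f = trans (∑-cong (allFin n) (λ i _ → ∑-*ˡ (allFin n) c (f i))) (∑-*ˡ (allFin n) c _)

  ∑²-permute : ∀ {τ} → IsPerm τ → ∀ f → ∑² (λ i j → f (τ i) (τ j)) ≡ ∑² f
  ∑²-permute {τ} τ-perm f = trans (∑-cong (allFin n) (λ i _ → ∑-permuteFin τ-perm (f (τ i))))
    (∑-permuteFin τ-perm (λ a → ∑ (allFin n) (f a)))

  flips : Fin n → Fin n → ℕ
  flips a b = [ a <ᶠ b ∧ σ b <ᶠ σ a ]ᴺ ℕ.+ [ b <ᶠ a ∧ σ a <ᶠ σ b ]ᴺ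

  flips-sym : ∀ a b → flips a b ≡ flips b a
  flips-sym a b = ℕP.+-comm [ a <ᶠ b ∧ σ b <ᶠ σ a ]ᴺ _

  flips-diag : ∀ a → flips a a ≡ 0
  flips-diag a rewrite <ᶠ-irrefl a = refl

  flipsAlong : (Fin n → Fin n) → ℕ
  flipsAlong τ = ∑² (λ i j → [ i <ᶠ j ]ᴺ ℕ.* flips (τ i) (τ j))

  ∑²-flips≡2*flipsAlong : ∀ τ → ∑² (λ i j → flips (τ i) (τ j)) ≡ 2 ℕ.* flipsAlong τ
  ∑²-flips≡2*flipsAlong τ = begin
    ∑² (λ i j → flips (τ i) (τ j))
      ≡⟨ ∑²-cong split ⟩
    ∑² (λ i j → [ i <ᶠ j ]ᴺ ℕ.* flips (τ i) (τ j) ℕ.+ [ j <ᶠ i ]ᴺ ℕ.* flips (τ i) (τ j))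
      ≡⟨ ∑²-+ _ _ ⟩
    flipsAlong τ ℕ.+ ∑² (λ i j → [ j <ᶠ i ]ᴺ ℕ.* flips (τ i) (τ j))
      ≡⟨ cong (flipsAlong τ ℕ.+_) (∑-swap (allFin n) (allFin n) _) ⟩
    flipsAlong τ ℕ.+ ∑² (λ j i → [ j <ᶠ i ]ᴺ ℕ.* flips (τ i) (τ j))
      ≡⟨ cong (flipsAlong τ ℕ.+_) (∑²-cong λ j i → cong ([ j <ᶠ i ]ᴺ ℕ.*_) (flips-sym (τ i) (τ j))) ⟩
    flipsAlong τ ℕ.+ flipsAlong τ
      ≡⟨ cong (flipsAlong τ ℕ.+_) (ℕP.+-identityʳ (flipsAlong τ)) ⟨
    2 ℕ.* flipsAlong τ
      ∎
    where
    open ≡-Reasoning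
    split : ∀ i j → flips (τ i) (τ j) ≡ [ i <ᶠ j ]ᴺ ℕ.* flips (τ i) (τ j) ℕ.+ [ j <ᶠ i ]ᴺ ℕ.* flips (τ i) (τ j)
    split i j with i ≟F j
    ... | yes refl rewrite flips-diag (τ i) | ℕP.*-zeroʳ [ i <ᶠ i ]ᴺ = refl
    ... | no i≢j with i <ᶠ j in i<j | j <ᶠ i in j<i
    ...   | true  | true  with () ← trans (sym (<ᶠ-asym i j i<j)) j<i
    ...   | false | false with () ← trans (sym i<j) (trans (<ᶠ-connex i j i≢j) (cong not j<i))
    ...   | true  | false = sym (trans (ℕP.+-identityʳ _) (ℕP.+-identityʳ _))
    ...   | false | true  = sym (ℕP.+-identityʳ _)

  flipsAlong-id : flipsAlong id ≡ inversions σ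
  flipsAlong-id = ∑²-cong ordered
    where
    ordered : ∀ a b → [ a <ᶠ b ]ᴺ ℕ.* flips a b ≡ [ a <ᶠ b ∧ σ b <ᶠ σ a ]ᴺ
    ordered a b with a <ᶠ b in a<b
    ... | false = refl
    ... | true rewrite <ᶠ-asym a b a<b = trans (ℕP.+-identityʳ _) (ℕP.+-identityʳ _)

  flipsAlong≡inversions : ∀ {τ} → IsPerm τ → flipsAlong τ ≡ inversions σ
  flipsAlong≡inversions {τ} τ-perm = trans (ℕP.*-cancelˡ-≡ (flipsAlong τ) (flipsAlong id) 2 (begin
    2 ℕ.* flipsAlong τ                ≡⟨ ∑²-flips≡2*flipsAlong τ ⟨
    ∑² (λ i j → flips (τ i) (τ j))    ≡⟨ ∑²-permute τ-perm flips ⟩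
    ∑² flips                          ≡⟨ ∑²-flips≡2*flipsAlong id ⟩
    2 ℕ.* flipsAlong id               ∎)) flipsAlong-id
    where open ≡-Reasoning

  inversions-∘ : ∀ {τ} → IsPerm τ → ∃ λ X → inversions (σ ∘ₚ τ) ℕ.+ 2 ℕ.* X ≡ inversions τ ℕ.+ inversions σ
  inversions-∘ {τ} τ-perm = ∑² restored , (begin
    inversions (σ ∘ₚ τ) ℕ.+ 2 ℕ.* ∑² restored
      ≡⟨ cong (inversions (σ ∘ₚ τ) ℕ.+_) (∑²-*ˡ 2 restored) ⟨
    inversions (σ ∘ₚ τ) ℕ.+ ∑² (λ i j → 2 ℕ.* restored i j)
      ≡⟨ ∑²-+ _ _ ⟨
    ∑² (λ i j → [ i <ᶠ j ∧ σ (τ j) <ᶠ σ (τ i) ]ᴺ ℕ.+ 2 ℕ.* restored i j)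
      ≡⟨ ∑²-cong pointwise ⟩
    ∑² (λ i j → [ i <ᶠ j ∧ τ j <ᶠ τ i ]ᴺ ℕ.+ [ i <ᶠ j ]ᴺ ℕ.* flips (τ i) (τ j))
      ≡⟨ ∑²-+ _ _ ⟩
    inversions τ ℕ.+ flipsAlong τ
      ≡⟨ cong (inversions τ ℕ.+_) (flipsAlong≡inversions τ-perm) ⟩
    inversions τ ℕ.+ inversions σ
      ∎)
    where
    open ≡-Reasoning
    restored : Fin n → Fin n → ℕ
    restored i j = [ i <ᶠ j ∧ (τ j <ᶠ τ i ∧ σ (τ i) <ᶠ σ (τ j)) ]ᴺ

    pointwise : ∀ i j → [ i <ᶠ j ∧ σ (τ j) <ᶠ σ (τ i) ]ᴺ ℕ.+ 2 ℕ.* restored i j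
                      ≡ [ i <ᶠ j ∧ τ j <ᶠ τ i ]ᴺ ℕ.+ [ i <ᶠ j ]ᴺ ℕ.* flips (τ i) (τ j)
    pointwise i j with i <ᶠ j in i<j
    ... | false = refl
    ... | true
      rewrite <ᶠ-connex (τ i) (τ j) (<ᶠ⇒≢ i<j ∘ τ-perm)
            | <ᶠ-connex (σ (τ i)) (σ (τ j)) (<ᶠ⇒≢ i<j ∘ τ-perm ∘ σ-perm)
      with τ j <ᶠ τ i | σ (τ j) <ᶠ σ (τ i)
    ... | true  | true  = refl
    ... | true  | false = refl
    ... | false | true  = refl
    ... | false | false = refl

signOf : ℕ → ℚ
signOf k = if parity k then 1ℚ else ℚ.- 1ℚ

signOf-+ : ∀ a b → signOf (a ℕ.+ b) ≡ signOf a * signOf b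
signOf-+ zero          b = sym (ℚP.*-identityˡ _)
signOf-+ (suc zero)    b = flip b
  where
  flip : ∀ b → signOf (suc b) ≡ ℚ.- 1ℚ * signOf b
  flip zero          = refl
  flip (suc zero)    = refl
  flip (suc (suc b)) = flip b
signOf-+ (suc (suc a)) b = signOf-+ a b

signOf-self : ∀ a → signOf a * signOf a ≡ 1ℚ
signOf-self a with parity a
... | true  = refl
... | false = refl

signOf-double : ∀ a → signOf (2 ℕ.* a) ≡ 1ℚ
signOf-double a = begin
  signOf (a ℕ.+ (a ℕ.+ 0))  ≡⟨ cong (λ b → signOf (a ℕ.+ b)) (ℕP.+-identityʳ a) ⟩
  signOf (a ℕ.+ a)          ≡⟨ signOf-+ a a ⟩
  signOf a * signOf a       ≡⟨ signOf-self a ⟩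
  1ℚ                        ∎
  where open ≡-Reasoning

sgn-∘ : ∀ {n} {σ τ : Fin n → Fin n} → IsPerm σ → IsPerm τ → sgn (σ ∘ₚ τ) ≡ sgn σ * sgn τ
sgn-∘ {σ = σ} {τ} σ-perm τ-perm with Inversions.inversions-∘ σ-perm τ-perm
... | X , inv∘+2X≡ = begin
  sgn (σ ∘ₚ τ)                                   ≡⟨ ℚP.*-identityʳ _ ⟨
  sgn (σ ∘ₚ τ) * 1ℚ                              ≡⟨ cong (sgn (σ ∘ₚ τ) *_) (signOf-double X) ⟨
  sgn (σ ∘ₚ τ) * signOf (2 ℕ.* X)                ≡⟨ signOf-+ (inversions (σ ∘ₚ τ)) _ ⟨
  signOf (inversions (σ ∘ₚ τ) ℕ.+ 2 ℕ.* X)       ≡⟨ cong signOf inv∘+2X≡ ⟩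
  signOf (inversions τ ℕ.+ inversions σ)         ≡⟨ signOf-+ (inversions τ) (inversions σ) ⟩
  sgn τ * sgn σ                                  ≡⟨ ℚP.*-comm (sgn τ) (sgn σ) ⟩
  sgn σ * sgn τ                                  ∎
  where open ≡-Reasoning

sgn-cong : ∀ {n} {σ σ′ : Fin n → Fin n} → σ ≗ σ′ → sgn σ ≡ sgn σ′
sgn-cong {n} {σ} {σ′} σ≗σ′ = cong signOf (Σℕ.∑-cong (allFin n) λ i _ → Σℕ.∑-cong (allFin n) λ j _ →
  cong₂ (λ a b → [ i <ᶠ j ∧ a <ᶠ b ]ᴺ) (σ≗σ′ j) (σ≗σ′ i))

sgn-id : ∀ {n} → sgn {n} id ≡ 1ℚ
sgn-id {n} = cong signOf (trans (Σℕ.∑-cong (allFin n) λ i _ →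
  trans (Σℕ.∑-cong (allFin n) λ j _ → no-inversion i j) (Σℕ.∑-zero (allFin n))) (Σℕ.∑-zero (allFin n)))
  where
  no-inversion : ∀ i j → [ i <ᶠ j ∧ j <ᶠ i ]ᴺ ≡ 0
  no-inversion i j with i <ᶠ j in i<j
  ... | false = refl
  ... | true rewrite <ᶠ-asym i j i<j = refl

sgn-self : ∀ {n} (σ : Fin n → Fin n) → sgn σ * sgn σ ≡ 1ℚ
sgn-self σ = signOf-self (inversions σ)

sgn-inv : ∀ {n} {ρ : Fin n → Fin n} → IsPerm ρ → sgn (inv ρ) ≡ sgn ρ
sgn-inv {n} {ρ} ρ-perm = begin
  sgn (inv ρ)                      ≡⟨ ℚP.*-identityˡ _ ⟨
  1ℚ * sgn (inv ρ)                 ≡⟨ cong (_* sgn (inv ρ)) (sgn-self ρ) ⟨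
  (sgn ρ * sgn ρ) * sgn (inv ρ)    ≡⟨ ℚP.*-assoc (sgn ρ) (sgn ρ) _ ⟩
  sgn ρ * (sgn ρ * sgn (inv ρ))    ≡⟨ cong (sgn ρ *_) (sgn-∘ ρ-perm (inv-isPerm ρ-perm)) ⟨
  sgn ρ * sgn (ρ ∘ₚ inv ρ)         ≡⟨ cong (sgn ρ *_) (trans (sgn-cong (inv-inverseʳ ρ-perm)) (sgn-id {n})) ⟩
  sgn ρ * 1ℚ                       ≡⟨ ℚP.*-identityʳ _ ⟩
  sgn ρ                            ∎
  where open ≡-Reasoning

sgn-conjugate : ∀ {n} {ρ π : Fin n → Fin n} → IsPerm ρ → IsPerm π → sgn (ρ ∘ₚ (π ∘ₚ inv ρ)) ≡ sgn π
sgn-conjugate {ρ = ρ} {π} ρ-perm π-perm = begin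
  sgn (ρ ∘ₚ (π ∘ₚ inv ρ))          ≡⟨ sgn-∘ ρ-perm (∘ₚ-isPerm π-perm (inv-isPerm ρ-perm)) ⟩
  sgn ρ * sgn (π ∘ₚ inv ρ)         ≡⟨ cong (sgn ρ *_) (sgn-∘ π-perm (inv-isPerm ρ-perm)) ⟩
  sgn ρ * (sgn π * sgn (inv ρ))    ≡⟨ cong (λ z → sgn ρ * (sgn π * z)) (sgn-inv ρ-perm) ⟩
  sgn ρ * (sgn π * sgn ρ)          ≡⟨ cong (sgn ρ *_) (ℚP.*-comm (sgn π) (sgn ρ)) ⟩
  sgn ρ * (sgn ρ * sgn π)          ≡⟨ ℚP.*-assoc (sgn ρ) (sgn ρ) (sgn π) ⟨
  (sgn ρ * sgn ρ) * sgn π          ≡⟨ cong (_* sgn π) (sgn-self ρ) ⟩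
  1ℚ * sgn π                       ≡⟨ ℚP.*-identityˡ (sgn π) ⟩
  sgn π                            ∎
  where open ≡-Reasoning

IsInt : ℚ → Set
IsInt q = ∃ λ (z : ℤ) → q ≡ z / 1

/1≡mkℚ : ∀ z → z / 1 ≡ mkℚ z 0 (Coprime.sym (Coprime.1-coprimeTo ℤ.∣ z ∣))
/1≡mkℚ (ℤ.+ n)    = ℚP.normalize-coprime (Coprime.sym (Coprime.1-coprimeTo n))
/1≡mkℚ -[1+ n ] = cong ℚ.-_ (ℚP.normalize-coprime (Coprime.sym (Coprime.1-coprimeTo (suc n))))

IsInt-+ : ∀ {p q} → IsInt p → IsInt q → IsInt (p ℚ.+ q)
IsInt-+ (a , refl) (b , refl) rewrite /1≡mkℚ a | /1≡mkℚ b = a ℤ.* ℤ.+ 1 ℤ.+ b ℤ.* ℤ.+ 1 , refl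

IsInt-∑ : {A : Set} (xs : List A) (f : A → ℚ) → (∀ x → x ∈ xs → IsInt (f x)) → IsInt (Σℚ.∑ xs f)
IsInt-∑ []       f ints = ℤ.+ 0 , refl
IsInt-∑ (x ∷ xs) f ints = IsInt-+ (ints x (here refl)) (IsInt-∑ xs f (λ y y∈ → ints y (there y∈)))

IsInt-sgn : ∀ {n} (σ : Fin n → Fin n) → IsInt (sgn σ)
IsInt-sgn σ with parity (inversions σ)
... | true  = ℤ.+ 1 , refl
... | false = -[1+ 0 ] , refl

toℚ : ℕ → ℚ
toℚ k = ℤ.+ k / 1

toℚ-∑ : {A : Set} (xs : List A) (f : A → ℕ) → toℚ (Σℕ.∑ xs f) ≡ Σℚ.∑ xs (toℚ ∘ f)
toℚ-∑ []       f = refl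
toℚ-∑ (x ∷ xs) f = trans (toℚ-+ (f x) _) (cong (toℚ (f x) ℚ.+_) (toℚ-∑ xs f))
  where
  toℚ-+ : ∀ a b → toℚ (a ℕ.+ b) ≡ toℚ a ℚ.+ toℚ b
  toℚ-+ a b rewrite /1≡mkℚ (ℤ.+ a) | /1≡mkℚ (ℤ.+ b) =
    cong (_/ 1) (sym (cong₂ ℤ._+_ (ℤP.*-identityʳ (ℤ.+ a)) (ℤP.*-identityʳ (ℤ.+ b))))

divℚ-*toℚ : ∀ x s → s ≢ 0 → divℚ x s * toℚ s ≡ x
divℚ-*toℚ x zero    s≢0 = ⊥-elim (s≢0 refl)
divℚ-*toℚ x (suc k) _   = begin
  (x * (ℤ.+ 1 / suc k)) * toℚ (suc k)     ≡⟨ ℚP.*-assoc x _ _ ⟩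
  x * ((ℤ.+ 1 / suc k) * toℚ (suc k))     ≡⟨ cong (x *_) 1/k*k≡1 ⟩
  x * 1ℚ                                ≡⟨ ℚP.*-identityʳ x ⟩
  x                                     ∎
  where
  open ≡-Reasoning
  1/k*k≡1 : (ℤ.+ 1 / suc k) * toℚ (suc k) ≡ 1ℚ
  1/k*k≡1 rewrite /1≡mkℚ (ℤ.+ suc k) | ℚP.normalize-coprime {1} {k} (Coprime.1-coprimeTo (suc k)) =
    ℚP.*-inverseˡ (mkℚ (ℤ.+ suc k) 0 (Coprime.sym (Coprime.1-coprimeTo (suc k))))

divℚ-*ˡ : ∀ a b s → divℚ (a * b) s ≡ a * divℚ b s
divℚ-*ˡ a b zero    = sym (ℚP.*-zeroʳ a)
divℚ-*ˡ a b (suc k) = ℚP.*-assoc a b _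

module Stabiliser {n} (L : Fin n → ℕ) where

  Preserves : (Fin n → Fin n) → Set
  Preserves σ = ∀ i → L (σ i) ≡ L i

  inStab : (Fin n → Fin n) → Bool
  inStab σ = allB (λ i → does (L (σ i) ℕP.≟ L i)) (allFin n)

  stab : List (Fin n → Fin n)
  stab = filter (λ σ → T? (inStab σ)) (allPerms n)

  inStab-sound : ∀ σ → inStab σ ≡ true → Preserves σ
  inStab-sound σ σ∈ i = does⇒witness (L (σ i) ℕP.≟ L i) (allB-sound _ (allFin n) σ∈ (∈P.∈-allFin i))

  inStab-complete : ∀ σ → Preserves σ → inStab σ ≡ true
  inStab-complete σ σ-pres = allB-complete _ (allFin n) (λ {i} _ → dec-true (L (σ i) ℕP.≟ L i) (σ-pres i))

  inStab-≡ : ∀ {σ σ′} → (Preserves σ → Preserves σ′) → (Preserves σ′ → Preserves σ) → inStab σ ≡ inStab σ′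
  inStab-≡ {σ} {σ′} to from with inStab σ in σ∈ | inStab σ′ in σ′∈
  ... | true  | true  = refl
  ... | false | false = refl
  ... | true  | false = trans (sym (inStab-complete σ′ (to (inStab-sound σ σ∈)))) σ′∈
  ... | false | true  = trans (sym σ∈) (inStab-complete σ (from (inStab-sound σ′ σ′∈)))

  inStab-cong : Respects≗ inStab
  inStab-cong σ≗σ′ = inStab-≡ (λ pres i → trans (cong L (sym (σ≗σ′ i))) (pres i))
                              (λ pres i → trans (cong L (σ≗σ′ i)) (pres i))

  ∈-stab⇒isPerm : ∀ {σ} → σ ∈ stab → IsPerm σ
  ∈-stab⇒isPerm σ∈ = ∈-allPerms⇒isPerm (proj₁ (∈P.∈-filter⁻ (λ σ → T? (inStab σ)) {xs = allPerms n} σ∈))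

  ∈-stab⇒preserves : ∀ {σ} → σ ∈ stab → Preserves σ
  ∈-stab⇒preserves {σ} σ∈ = inStab-sound σ
    (Equivalence.to T-≡ (proj₂ (∈P.∈-filter⁻ (λ σ → T? (inStab σ)) {xs = allPerms n} σ∈)))

  idₚ∈stab : idₚ ∈ stab
  idₚ∈stab = ∈P.∈-filter⁺ (λ σ → T? (inStab σ)) idₚ∈allPerms
    (Equivalence.from T-≡ (inStab-complete idₚ (λ i → cong L (idₚ-id i))))

  ∑-stab : (f : (Fin n → Fin n) → ℚ) → Σℚ.∑ stab f ≡ Σℚ.∑ (allPerms n) (λ π → if inStab π then f π else 0ℚ)
  ∑-stab = Σℚ.∑-filter (λ σ → T? (inStab σ)) (allPerms n)

  ∑-stab-reindex : (B : PermBijection n) → (∀ {π} → IsPerm π → inStab (PermBijection.to B π) ≡ inStab π) →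
    (f : (Fin n → Fin n) → ℚ) → Respects≗ f →
    Σℚ.∑ stab (f ∘ PermBijection.to B) ≡ Σℚ.∑ stab f
  ∑-stab-reindex B to-stab f f-resp = begin
    ∑ stab (f ∘ to)
      ≡⟨ ∑-stab (f ∘ to) ⟩
    ∑ (allPerms n) (λ π → if inStab π then f (to π) else 0ℚ)
      ≡⟨ ∑-cong (allPerms n) restrict ⟩
    ∑ (allPerms n) (restricted ∘ to)
      ≡⟨ ∑-allPerms-reindex B restricted restricted-resp ⟩
    ∑ (allPerms n) restricted
      ≡⟨ ∑-stab f ⟨
    ∑ stab f
      ∎
    where
    open ≡-Reasoning
    open Σℚ
    open PermBijection B using (to)
    restricted : (Fin n → Fin n) → ℚ
    restricted π = if inStab π then f π else 0ℚ
    restricted-resp : Respects≗ restricted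
    restricted-resp π≗π′ = cong₂ (λ b y → if b then y else 0ℚ) (inStab-cong π≗π′) (f-resp π≗π′)
    restrict : ∀ π → π ∈ allPerms n → (if inStab π then f (to π) else 0ℚ) ≡ restricted (to π)
    restrict π π∈ = cong (λ b → if b then f (to π) else 0ℚ) (sym (to-stab (∈-allPerms⇒isPerm π∈)))

  ∑-stab-leftMul : ∀ {ρ} → IsPerm ρ → Preserves ρ → (f : (Fin n → Fin n) → ℚ) → Respects≗ f →
    Σℚ.∑ stab (λ π → f (ρ ∘ₚ π)) ≡ Σℚ.∑ stab f
  ∑-stab-leftMul {ρ} ρ-perm ρ-pres = ∑-stab-reindex (leftMultiplication ρ-perm) λ {π} _ →
    inStab-≡ (λ pres i → trans (sym (ρ-pres (π i))) (pres i)) (λ pres i → trans (ρ-pres (π i)) (pres i))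

rowLen-antitone : ∀ {λ′} → Linked ℕ._≥_ λ′ → ∀ {r₁ r₂} → r₁ ≤ r₂ → rowLen λ′ r₂ ≤ rowLen λ′ r₁
rowLen-antitone {λ′} decr {r₁} r₁≤r₂ with ℕP.m≤n⇒m<n∨m≡n r₁≤r₂
... | inj₂ refl = ℕP.≤-refl
rowLen-antitone {λ′} decr {r₁} {suc r₂} r₁≤r₂ | inj₁ r₁<1+r₂ =
  ℕP.≤-trans (rowLen-suc λ′ decr r₂) (rowLen-antitone decr (ℕP.≤-pred r₁<1+r₂))
  where
  rowLen-suc : ∀ λ′ → Linked ℕ._≥_ λ′ → ∀ r → rowLen λ′ (suc r) ≤ rowLen λ′ r
  rowLen-suc []           _              r       = z≤n
  rowLen-suc (x ∷ [])     _              zero    = z≤n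
  rowLen-suc (x ∷ [])     _              (suc r) = z≤n
  rowLen-suc (x ∷ y ∷ xs) (x≥y Linked.∷ _) zero    = x≥y
  rowLen-suc (x ∷ y ∷ xs) (_ Linked.∷ decr) (suc r) = rowLen-suc (y ∷ xs) decr r

module _ {n λ′} (T : Filling n λ′) where
  open Filling T

  sameBox⇒≡ : ∀ {i j} → rowOf T i ≡ rowOf T j → colOf T i ≡ colOf T j → i ≡ j
  sameBox⇒≡ r c = inj (cong₂ _,_ r c)

  pos-entryAt : ∀ d b → InDiagram λ′ b → pos (entryAt T d b) ≡ b
  pos-entryAt d b b∈λ with onto b b∈λ
  ... | x , pos-x with filter (λ i → ≡-dec× ℕP._≟_ ℕP._≟_ (pos i) b) (allFin n) in eq
  ...   | [] with () ← subst (x ∈_) eq (∈P.∈-filter⁺ (λ i → ≡-dec× ℕP._≟_ ℕP._≟_ (pos i) b) (∈P.∈-allFin x) pos-x)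
  ...   | y ∷ _ = proj₂ (∈P.∈-filter⁻ (λ i → ≡-dec× ℕP._≟_ ℕP._≟_ (pos i) b) {xs = allFin n}
                                      (subst (y ∈_) (sym eq) (here refl)))

module _ {n λ′} (T S : Filling n λ′) where

  relabel : Fin n → Fin n
  relabel i = proj₁ (Filling.onto S (Filling.pos T i) (Filling.inDiag T i))

  pos-relabel : ∀ i → Filling.pos S (relabel i) ≡ Filling.pos T i
  pos-relabel i = proj₂ (Filling.onto S (Filling.pos T i) (Filling.inDiag T i))

  relabel-isPerm : IsPerm relabel
  relabel-isPerm {i} {j} eq =
    Filling.inj T (trans (sym (pos-relabel i)) (trans (cong (Filling.pos S) eq) (pos-relabel j)))

  ctBox-pos : ∀ e → ctBox S (Filling.pos S e) ≡ ctEntry S e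
  ctBox-pos e = Σℕ.∑-indicator (allFin n) (λ e′ → does (box≟ (Filling.pos S e′))) (ctEntry S)
    (UniqueP.allFin⁺ n) (∈P.∈-allFin e)
    (λ e′ hit → Filling.inj S (does⇒witness (box≟ (Filling.pos S e′)) hit)) (dec-true (box≟ _) refl)
    where
    box≟ : ∀ b → Dec (b ≡ Filling.pos S e)
    box≟ b = ≡-dec× ℕP._≟_ ℕP._≟_ b (Filling.pos S e)

  lookup-pTS : ∀ i → lookup (pTS T S) i ≡ ctEntry S (relabel i)
  lookup-pTS i = trans (VecP.lookup∘tabulate _ i)
    (trans (cong (ctBox S) (sym (pos-relabel i))) (ctBox-pos (relabel i)))

  degree-pTS : degree (pTS T S) ≡ cc S
  degree-pTS = trans (degree-∑ (pTS T S))
    (trans (Σℕ.∑-cong (allFin n) (λ i _ → lookup-pTS i)) (Σℕ.∑-permuteFin relabel-isPerm (ctEntry S)))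

_≟ₘ_ : ∀ {n} → (u v : Monomial n) → Dec (u ≡ v)
_≟ₘ_ = VecP.≡-dec ℕP._≟_

if-then-0≡*toℚ : ∀ b y → (if b then y else 0ℚ) ≡ y * toℚ [ b ]ᴺ
if-then-0≡*toℚ true  y = sym (ℚP.*-identityʳ y)
if-then-0≡*toℚ false y = sym (ℚP.*-zeroʳ y)

module HigherSpecht {n λ′} (T S : Filling n λ′) where
  module R = Stabiliser (rowOf T)
  module C = Stabiliser (colOf T)

  p : Monomial n
  p = pTS T S

  s : ℕ
  s = sTS T S

  weight : (Fin n → Fin n) → ℚ
  weight σ = divℚ (sgn σ * 1ℚ) s

  weight-cong : Respects≗ weight
  weight-cong σ≗σ′ = cong (λ z → divℚ (z * 1ℚ) s) (sgn-cong σ≗σ′)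

  weight-leftMul : ∀ {ρ σ} → IsPerm ρ → IsPerm σ → weight σ ≡ sgn ρ * weight (ρ ∘ₚ σ)
  weight-leftMul {ρ} {σ} ρ-perm σ-perm = begin
    divℚ (sgn σ * 1ℚ) s                        ≡⟨ cong (λ z → divℚ (z * 1ℚ) s) sgnσ≡ ⟩
    divℚ ((sgn ρ * sgn (ρ ∘ₚ σ)) * 1ℚ) s       ≡⟨ cong (λ z → divℚ z s) (ℚP.*-assoc (sgn ρ) _ 1ℚ) ⟩
    divℚ (sgn ρ * (sgn (ρ ∘ₚ σ) * 1ℚ)) s       ≡⟨ divℚ-*ˡ (sgn ρ) _ s ⟩
    sgn ρ * divℚ (sgn (ρ ∘ₚ σ) * 1ℚ) s         ∎
    where
    open ≡-Reasoning
    sgnσ≡ : sgn σ ≡ sgn ρ * sgn (ρ ∘ₚ σ)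
    sgnσ≡ = begin
      sgn σ                        ≡⟨ ℚP.*-identityˡ (sgn σ) ⟨
      1ℚ * sgn σ                   ≡⟨ cong (_* sgn σ) (sgn-self ρ) ⟨
      (sgn ρ * sgn ρ) * sgn σ      ≡⟨ ℚP.*-assoc (sgn ρ) (sgn ρ) (sgn σ) ⟩
      sgn ρ * (sgn ρ * sgn σ)      ≡⟨ cong (sgn ρ *_) (sgn-∘ ρ-perm σ-perm) ⟨
      sgn ρ * sgn (ρ ∘ₚ σ)         ∎

  hits : (Fin n → Fin n) → Monomial n → ℚ → ℚ
  hits σ m x = Σℚ.∑ R.stab (λ τ → if does (actMon (σ ∘ₚ τ) p ≟ₘ m) then x else 0ℚ)

  ∑-FTS : (h : ℚ × Monomial n → ℚ) →
    Σℚ.∑ (FTS T S) h ≡ Σℚ.∑ C.stab (λ σ → Σℚ.∑ R.stab (λ τ → h (weight σ , actMon (σ ∘ₚ τ) p)))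
  ∑-FTS h = trans (∑-map (εT T ((1ℚ , p) ∷ [])) _ h) (trans (∑-concatMap C.stab _ _)
    (∑-cong C.stab λ σ _ → trans (∑-concatMap R.stab _ _) (∑-cong R.stab λ τ _ → ℚP.+-identityʳ _)))
    where open Σℚ

  coeff-FTS : ∀ m → coeff (FTS T S) m ≡ Σℚ.∑ C.stab (λ σ → hits σ m (weight σ))
  coeff-FTS m = ∑-FTS _

  s≢0 : s ≢ 0
  s≢0 s≡0 = ℕP.<-irrefl (sym s≡0) (ℕP.≤-trans (ℕP.≤-reflexive (cong [_]ᴺ (sym idₚ-fixes)))
    (Σℕ.term≤∑ R.stab (λ τ → [ does (actMon τ p ≟ₘ p) ]ᴺ) R.idₚ∈stab))
    where
    idₚ-fixes : does (actMon idₚ p ≟ₘ p) ≡ true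
    idₚ-fixes = dec-true (actMon idₚ p ≟ₘ p) (actMon-≗id idₚ-id p)

  -- στp ≡ m exactly for τ in the coset τ₀ R_p of the stabiliser R_p of p in R(T), and |R_p| = s.
  hits-orbit : ∀ {σ τ₀ m} x → IsPerm σ → τ₀ ∈ R.stab → actMon (σ ∘ₚ τ₀) p ≡ m → hits σ m (divℚ x s) ≡ x
  hits-orbit {σ} {τ₀} {m} x σ-perm τ₀∈ στ₀p≡m = begin
    hits σ m (divℚ x s)                   ≡⟨ ∑-cong R.stab (λ τ _ → if-then-0≡*toℚ _ (divℚ x s)) ⟩
    ∑ R.stab (λ τ → divℚ x s * hit τ)     ≡⟨ ∑-*ˡ R.stab (divℚ x s) hit ⟩
    divℚ x s * ∑ R.stab hit               ≡⟨ cong (divℚ x s *_) hit-count ⟩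
    divℚ x s * toℚ s                      ≡⟨ divℚ-*toℚ x s s≢0 ⟩
    x                                     ∎
    where
    open ≡-Reasoning
    open Σℚ
    στ₀-perm : IsPerm (σ ∘ₚ τ₀)
    στ₀-perm = ∘ₚ-isPerm σ-perm (R.∈-stab⇒isPerm τ₀∈)

    hit : (Fin n → Fin n) → ℚ
    hit τ = toℚ [ does (actMon (σ ∘ₚ τ) p ≟ₘ m) ]ᴺ

    hit-cong : Respects≗ hit
    hit-cong τ≗τ′ = cong (λ v → toℚ [ does (v ≟ₘ m) ]ᴺ) (actMon-cong (λ i → cong σ (τ≗τ′ i)) p)

    hit-shift : ∀ τ → τ ∈ R.stab → hit (τ₀ ∘ₚ τ) ≡ toℚ [ does (actMon τ p ≟ₘ p) ]ᴺ
    hit-shift τ τ∈ = cong (λ b → toℚ [ b ]ᴺ) (does-⇔ (mk⇔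
      (λ στ₀τp≡m → actMon-injective στ₀-perm
         (trans (sym (actMon-∘ στ₀-perm τ-perm p)) (trans στ₀τp≡m (sym στ₀p≡m))))
      (λ τp≡p → trans (actMon-∘ στ₀-perm τ-perm p) (trans (cong (actMon (σ ∘ₚ τ₀)) τp≡p) στ₀p≡m)))
      (actMon (σ ∘ₚ (τ₀ ∘ₚ τ)) p ≟ₘ m) (actMon τ p ≟ₘ p))
      where
      τ-perm : IsPerm τ
      τ-perm = R.∈-stab⇒isPerm τ∈

    hit-count : ∑ R.stab hit ≡ toℚ s
    hit-count = begin
      ∑ R.stab hit
        ≡⟨ R.∑-stab-leftMul (R.∈-stab⇒isPerm τ₀∈) (R.∈-stab⇒preserves τ₀∈) hit hit-cong ⟨
      ∑ R.stab (λ τ → hit (τ₀ ∘ₚ τ))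
        ≡⟨ ∑-cong R.stab hit-shift ⟩
      ∑ R.stab (λ τ → toℚ [ does (actMon τ p ≟ₘ p) ]ᴺ)
        ≡⟨ toℚ-∑ R.stab _ ⟨
      toℚ s
        ∎

  hits-none : ∀ σ m x → (∀ τ → τ ∈ R.stab → actMon (σ ∘ₚ τ) p ≢ m) → hits σ m x ≡ 0ℚ
  hits-none σ m x misses = trans
    (Σℚ.∑-cong R.stab λ τ τ∈ → cong (λ b → if b then x else 0ℚ) (dec-false (_ ≟ₘ m) (misses τ τ∈)))
    (Σℚ.∑-zero R.stab)

  coeff-integral : ∀ m → IsInt (coeff (FTS T S) m)
  coeff-integral m = subst IsInt (sym (coeff-FTS m)) (IsInt-∑ C.stab _ λ σ σ∈ → integral σ (C.∈-stab⇒isPerm σ∈))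
    where
    integral : ∀ σ → IsPerm σ → IsInt (hits σ m (weight σ))
    integral σ σ-perm with Any.any? (λ τ → actMon (σ ∘ₚ τ) p ≟ₘ m) R.stab
    ... | yes hit with τ₀ , τ₀∈ , στ₀p≡m ← find hit =
      subst IsInt (sym (trans (hits-orbit (sgn σ * 1ℚ) σ-perm τ₀∈ στ₀p≡m) (ℚP.*-identityʳ (sgn σ)))) (IsInt-sgn σ)
    ... | no miss = subst IsInt (sym (hits-none σ m (weight σ) λ τ τ∈ στp≡m → miss (lose τ∈ στp≡m))) (ℤ.+ 0 , refl)

  coeff-homogeneous : ∀ m → coeff (FTS T S) m ≢ 0ℚ → degree m ≡ cc S
  coeff-homogeneous m coeff≢0 with degree m ℕP.≟ cc S
  ... | yes deg≡ = deg≡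
  ... | no deg≢ = ⊥-elim (coeff≢0 (trans (coeff-FTS m) (trans (Σℚ.∑-cong C.stab vanish) (Σℚ.∑-zero C.stab))))
    where
    vanish : ∀ σ → σ ∈ C.stab → hits σ m (weight σ) ≡ 0ℚ
    vanish σ σ∈ = hits-none σ m (weight σ) λ τ τ∈ στp≡m → deg≢ (begin
      degree m                    ≡⟨ cong degree στp≡m ⟨
      degree (actMon (σ ∘ₚ τ) p)  ≡⟨ degree-actMon (∘ₚ-isPerm (C.∈-stab⇒isPerm σ∈) (R.∈-stab⇒isPerm τ∈)) p ⟩
      degree p                    ≡⟨ degree-pTS T S ⟩
      cc S                        ∎)
      where open ≡-Reasoning

-- The charge tableau of a standard tableau increases down columns

nextFin-suc : ∀ {n} (a : Fin n) → suc (toℕ a) < n → ∃ λ b → nextFin a ≡ just b × toℕ b ≡ suc (toℕ a)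
nextFin-suc {suc zero}    Fin.zero    (s≤s ())
nextFin-suc {suc (suc n)} Fin.zero    _           = Fin.suc Fin.zero , refl , refl
nextFin-suc {suc (suc n)} (Fin.suc a) (s≤s 2+a≤n) with nextFin-suc a 2+a≤n
... | b , next≡b , b≡1+a rewrite next≡b = Fin.suc b , refl , cong suc b≡1+a

[∧]ᴺ-mono : ∀ {b₁ b₂} d → (b₁ ≡ true → b₂ ≡ true) → [ b₁ ∧ d ]ᴺ ≤ [ b₂ ∧ d ]ᴺ
[∧]ᴺ-mono {false} d _     = z≤n
[∧]ᴺ-mono {true}  d b₁⇒b₂ rewrite b₁⇒b₂ refl = ℕP.≤-refl

module Standard {n λ′} (S : Filling n λ′) (std : IsStandard S) where
  open Filling S

  rowIncreasing : ∀ i j → rowOf S i ≡ rowOf S j → colOf S i < colOf S j → toℕ i < toℕ j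
  rowIncreasing = proj₁ std

  colIncreasing : ∀ i j → colOf S i ≡ colOf S j → rowOf S i < rowOf S j → toℕ i < toℕ j
  colIncreasing = proj₂ std

  -- Otherwise the box below x in the row of b would hold an entry strictly between x and x + 1.
  lower-successor⇒descent : ∀ {x b} → nextFin x ≡ just b → toℕ b ≡ suc (toℕ x) →
    rowOf S x < rowOf S b → isDsi S x ≡ true
  lower-successor⇒descent {x} {b} next≡b b≡1+x x↓b rewrite next≡b =
    cong₂ _∧_ (dec-true (rowOf S x ℕP.<? rowOf S b) x↓b)
              (dec-true (colOf S b ℕP.≤? colOf S x) (ℕP.≮⇒≥ b-not-right))
    where
    b-not-right : ¬ colOf S x < colOf S b
    b-not-right x←b = ℕP.<⇒≱ x<e (ℕP.≤-pred (subst (toℕ e <_) b≡1+x e<b))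
      where
      corner : ∃ λ e → pos e ≡ (rowOf S b , colOf S x)
      corner = onto (rowOf S b , colOf S x) (ℕP.<-trans x←b (inDiag b))
      e : Fin n
      e = proj₁ corner
      x<e : toℕ x < toℕ e
      x<e = colIncreasing x e (sym (cong proj₂ (proj₂ corner)))
                              (subst (rowOf S x <_) (sym (cong proj₁ (proj₂ corner))) x↓b)
      e<b : toℕ e < toℕ b
      e<b = rowIncreasing e b (cong proj₁ (proj₂ corner))
                              (subst (_< colOf S b) (sym (cong proj₂ (proj₂ corner))) x←b)

  private
    <-of-≡+suc : ∀ {m n k} → n ≡ m ℕ.+ suc k → m < n
    <-of-≡+suc {m} refl = ℕP.m<m+n m (s≤s z≤n)

  descent-between : ∀ k {x y} → toℕ y ≡ toℕ x ℕ.+ suc k → rowOf S x < rowOf S y →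
    ∃ λ a → toℕ x ≤ toℕ a × toℕ a < toℕ y × isDsi S a ≡ true
  descent-between k {x} {y} y≡x+1+k x↓y
    with nextFin-suc x (ℕP.≤-<-trans (<-of-≡+suc y≡x+1+k) (FinP.toℕ<n y))
  ... | b , next≡b , b≡1+x with rowOf S x ℕP.<? rowOf S b
  ... | yes x↓b = x , ℕP.≤-refl , <-of-≡+suc y≡x+1+k , lower-successor⇒descent next≡b b≡1+x x↓b
  descent-between zero {x} {y} y≡x+1 x↓y | b , next≡b , b≡1+x | no x↓̸b =
    ⊥-elim (x↓̸b (subst (λ z → rowOf S x < rowOf S z) (sym b≡y) x↓y))
    where
    b≡y : b ≡ y
    b≡y = FinP.toℕ-injective (trans b≡1+x (trans (ℕP.+-comm 1 (toℕ x)) (sym y≡x+1)))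
  descent-between (suc k) {x} {y} y≡x+2+k x↓y | b , next≡b , b≡1+x | no x↓̸b
    with descent-between k {b} {y} y≡b+1+k (ℕP.≤-<-trans (ℕP.≮⇒≥ x↓̸b) x↓y)
    where
    y≡b+1+k : toℕ y ≡ toℕ b ℕ.+ suc k
    y≡b+1+k = trans y≡x+2+k (trans (ℕP.+-suc (toℕ x) (suc k)) (cong (ℕ._+ suc k) (sym b≡1+x)))
  ... | a , b≤a , a<y , a-descent =
    a , ℕP.≤-trans (ℕP.n≤1+n (toℕ x)) (subst (_≤ toℕ a) b≡1+x b≤a) , a<y , a-descent

  ctEntry-column-increasing : ∀ {x y} → colOf S x ≡ colOf S y → rowOf S x < rowOf S y → ctEntry S x < ctEntry S y
  ctEntry-column-increasing {x} {y} x|y x↓y with descent-between (toℕ y ℕ.∸ suc (toℕ x)) y≡x+1+k x↓y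
    where
    y≡x+1+k : toℕ y ≡ toℕ x ℕ.+ suc (toℕ y ℕ.∸ suc (toℕ x))
    y≡x+1+k = sym (trans (ℕP.+-suc (toℕ x) _) (ℕP.m+[n∸m]≡n (colIncreasing x y x|y x↓y)))
  ... | a , x≤a , a<y , a-descent = Σℕ.∑-mono-< (allFin n)
    (λ c _ → [∧]ᴺ-mono (isDsi S c) (λ c<x → dec-true (toℕ c ℕP.<? toℕ y)
      (ℕP.<-trans (does⇒witness (toℕ c ℕP.<? toℕ x) c<x) (colIncreasing x y x|y x↓y))))
    (∈P.∈-allFin a) counted-for-y-only
    where
    counted-for-y-only : [ (toℕ a ℕ.<ᵇ toℕ x) ∧ isDsi S a ]ᴺ < [ (toℕ a ℕ.<ᵇ toℕ y) ∧ isDsi S a ]ᴺ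
    counted-for-y-only rewrite a-descent | dec-false (toℕ a ℕP.<? toℕ x) (ℕP.≤⇒≯ x≤a)
                             | dec-true (toℕ a ℕP.<? toℕ y) a<y = s≤s z≤n

module LeadingCoefficient {n λ′} (T S : Filling n λ′) (std : IsStandard S) where
  open HigherSpecht T S
  open Standard S std

  a : Fin n → ℕ
  a = lookup p

  exponent-column-increasing : ∀ {i j} → colOf T i ≡ colOf T j → rowOf T i < rowOf T j → a i < a j
  exponent-column-increasing {i} {j} i|j i↓j = subst₂ _<_ (sym (lookup-pTS T S i)) (sym (lookup-pTS T S j))
    (ctEntry-column-increasing
      (trans (cong proj₂ (pos-relabel T S i)) (trans i|j (sym (cong proj₂ (pos-relabel T S j)))))
      (subst₂ _<_ (sym (cong proj₁ (pos-relabel T S i))) (sym (cong proj₁ (pos-relabel T S j))) i↓j))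

  module _ {σ τ} (σ-perm : IsPerm σ) (σ-col : C.Preserves σ) (τ-perm : IsPerm τ) (τ-row : R.Preserves τ)
           (στp≡p : actMon (σ ∘ₚ τ) p ≡ p) where

    a∘στ≗a : ∀ k → a (σ (τ k)) ≡ a k
    a∘στ≗a k = trans (cong (λ v → lookup v (σ (τ k))) (sym στp≡p)) (lookup-actMon (∘ₚ-isPerm σ-perm τ-perm) p k)

    FixedAbove : ℕ → Set
    FixedAbove r = ∀ j → rowOf T j < r → σ j ≡ j

    -- σ moves an entry of row r only downwards in its column, where the exponents are larger
    fixed-or-raised : ∀ {r} → FixedAbove r → ∀ {k} → rowOf T k ≡ r → σ k ≡ k ⊎ a k < a (σ k)
    fixed-or-raised {r} above {k} k∈r with ℕP.<-cmp (rowOf T (σ k)) r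
    ... | tri< σk↑ _ _ = inj₁ (σ-perm (above (σ k) σk↑))
    ... | tri≈ _ σk∈r _ = inj₁ (sameBox⇒≡ T (trans σk∈r (sym k∈r)) (σ-col k))
    ... | tri> _ _ σk↓ = inj₂ (exponent-column-increasing (sym (σ-col k)) (subst (_< rowOf T (σ k)) (sym k∈r) σk↓))

    fixed-row : ∀ {r} → FixedAbove r → ∀ j → rowOf T j ≡ r → σ j ≡ j
    fixed-row {r} above j j∈r with fixed-or-raised above j∈r
    ... | inj₁ σj≡j = σj≡j
    ... | inj₂ raised = ⊥-elim (ℕP.<-irrefl aj≡aσj raised)
      where
      onRow : Fin n → ℕ
      onRow k = if does (rowOf T k ℕP.≟ r) then a k else 0

      -- τ permutes row r and, since στ fixes the exponents, can only lower them there
      τ-lowers : ∀ k → onRow (τ k) ≤ onRow k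
      τ-lowers k = subst (_≤ onRow k) (cong (λ z → if does (z ℕP.≟ r) then a (τ k) else 0) (sym (τ-row k)))
        (if-then-0-mono (does (rowOf T k ℕP.≟ r)) (lowers ∘ does⇒witness (rowOf T k ℕP.≟ r)))
        where
        lowers : rowOf T k ≡ r → a (τ k) ≤ a k
        lowers k∈r with fixed-or-raised above (trans (τ-row k) k∈r)
        ... | inj₁ στk≡τk = ℕP.≤-reflexive (trans (cong a (sym στk≡τk)) (a∘στ≗a k))
        ... | inj₂ raised′ = ℕP.<⇒≤ (subst (a (τ k) <_) (a∘στ≗a k) raised′)

      k₀ : Fin n
      k₀ = proj₁ (isPerm⇒surjective τ-perm j)
      τk₀≡j : τ k₀ ≡ j
      τk₀≡j = proj₂ (isPerm⇒surjective τ-perm j)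

      aτk₀≡ak₀ : a (τ k₀) ≡ a k₀
      aτk₀≡ak₀ = if-true-≡
        (dec-true (rowOf T k₀ ℕP.≟ r) (trans (sym (τ-row k₀)) (trans (cong (rowOf T) τk₀≡j) j∈r)))
        (trans (cong (λ z → if does (z ℕP.≟ r) then a (τ k₀) else 0) (sym (τ-row k₀)))
               (perm-nonincreasing⇒invariant τ-perm onRow τ-lowers k₀))

      aj≡aσj : a j ≡ a (σ j)
      aj≡aσj = begin
        a j              ≡⟨ cong a τk₀≡j ⟨
        a (τ k₀)         ≡⟨ aτk₀≡ak₀ ⟩
        a k₀             ≡⟨ a∘στ≗a k₀ ⟨
        a (σ (τ k₀))     ≡⟨ cong (a ∘ σ) τk₀≡j ⟩
        a (σ j)          ∎
        where open ≡-Reasoning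

    fixed-above : ∀ r → FixedAbove r
    fixed-above zero    j ()
    fixed-above (suc r) j j<1+r with ℕP.m≤n⇒m<n∨m≡n (ℕP.≤-pred j<1+r)
    ... | inj₁ j<r = fixed-above r j j<r
    ... | inj₂ j∈r = fixed-row (fixed-above r) j j∈r

    στp≡p⇒σ≗id : σ ≗ id
    στp≡p⇒σ≗id j = fixed-above (suc (rowOf T j)) j (ℕP.n<1+n _)

  isId : (Fin n → Fin n) → Bool
  isId σ = does (FinP.all? (λ i → σ i ≟F i))

  hits-p : ∀ σ → σ ∈ C.stab → hits σ p (weight σ) ≡ (if isId σ then 1ℚ else 0ℚ)
  hits-p σ σ∈ = ≡-if-does (FinP.all? (λ i → σ i ≟F i)) fixed moved
    where
    σ-perm : IsPerm σ
    σ-perm = C.∈-stab⇒isPerm σ∈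

    fixed : σ ≗ id → hits σ p (weight σ) ≡ 1ℚ
    fixed σ≗id = begin
      hits σ p (weight σ)   ≡⟨ hits-orbit (sgn σ * 1ℚ) σ-perm R.idₚ∈stab σp≡p ⟩
      sgn σ * 1ℚ            ≡⟨ ℚP.*-identityʳ (sgn σ) ⟩
      sgn σ                 ≡⟨ sgn-cong σ≗id ⟩
      sgn {n} id            ≡⟨ sgn-id {n} ⟩
      1ℚ                    ∎
      where
      open ≡-Reasoning
      σp≡p : actMon (σ ∘ₚ idₚ) p ≡ p
      σp≡p = actMon-≗id (λ i → trans (σ≗id (idₚ i)) (idₚ-id i)) p

    moved : ¬ σ ≗ id → hits σ p (weight σ) ≡ 0ℚ
    moved σ≉id = hits-none σ p (weight σ) λ τ τ∈ στp≡p → σ≉id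
      (στp≡p⇒σ≗id σ-perm (C.∈-stab⇒preserves σ∈) (R.∈-stab⇒isPerm τ∈) (R.∈-stab⇒preserves τ∈) στp≡p)

  coeff-leading : coeff (FTS T S) p ≡ 1ℚ
  coeff-leading = begin
    coeff (FTS T S) p
      ≡⟨ coeff-FTS p ⟩
    ∑ C.stab (λ σ → hits σ p (weight σ))
      ≡⟨ ∑-cong C.stab hits-p ⟩
    ∑ C.stab (λ σ → if isId σ then 1ℚ else 0ℚ)
      ≡⟨ C.∑-stab _ ⟩
    ∑ (allPerms n) (λ π → if C.inStab π then (if isId π then 1ℚ else 0ℚ) else 0ℚ)
      ≡⟨ ∑-cong (allPerms n) (λ π _ → nested-if (C.inStab π)) ⟩
    ∑ (allPerms n) (λ π → if C.inStab π ∧ isId π then 1ℚ else 0ℚ)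
      ≡⟨ ∑-allPerms-indicator-idₚ _ only-id idₚ-in ⟩
    1ℚ
      ∎
    where
    open ≡-Reasoning
    open Σℚ
    nested-if : ∀ b {c} → (if b then (if c then 1ℚ else 0ℚ) else 0ℚ) ≡ (if b ∧ c then 1ℚ else 0ℚ)
    nested-if true  = refl
    nested-if false = refl
    only-id : ∀ π → C.inStab π ∧ isId π ≡ true → π ≗ id
    only-id π hit = does⇒witness (FinP.all? (λ i → π i ≟F i)) (∧-conicalʳ (C.inStab π) (isId π) hit)
    idₚ-in : C.inStab idₚ ∧ isId idₚ ≡ true
    idₚ-in = cong₂ _∧_ (C.inStab-complete idₚ (λ i → cong (colOf T) (idₚ-id i)))
                       (dec-true (FinP.all? (λ i → idₚ {n} i ≟F i)) idₚ-id)

-- Factoring g ∈ C̃(T) as η_g ∘ c with η_g ∈ R(T) and c ∈ C(T)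

module ColumnPermuting {n λ′} (part : Partition n λ′) (T : Filling n λ′) {g} (g∈C̃ : InCtilde T g) where
  open Filling T
  module R = Stabiliser (rowOf T)
  module C = Stabiliser (colOf T)

  g-perm : IsPerm g
  g-perm = proj₁ g∈C̃

  g-respects-columns : ∀ {e e′} → colOf T e ≡ colOf T e′ → colOf T (g e) ≡ colOf T (g e′)
  g-respects-columns {e} {e′} e|e′ with proj₂ g∈C̃ (colOf T e) (e , refl)
  ... | _ , into , _ = trans (into e refl) (sym (into e′ (sym e|e′)))

  g-reflects-columns : ∀ {e e′} → colOf T (g e) ≡ colOf T (g e′) → colOf T e ≡ colOf T e′
  g-reflects-columns {e} {e′} ge|ge′ with proj₂ g∈C̃ (colOf T e) (e , refl)
  ... | _ , into , onto with onto (g e′) (trans (sym ge|ge′) (into e refl))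
  ...   | e″ , e″|e , ge″≡ge′ = trans (sym e″|e) (cong (colOf T) (g-perm ge″≡ge′))

  -- Otherwise g would squeeze the r + 1 top entries of the column of x into the rows above r of another column.
  g-target-in-diagram : ∀ x → InDiagram λ′ (rowOf T x , colOf T (g x))
  g-target-in-diagram x with colOf T (g x) ℕP.<? rowLen λ′ (rowOf T x)
  ... | yes inside = inside
  ... | no outside = ⊥-elim (ℕP.<-irrefl refl (FinP.injective⇒≤ squeeze-injective))
    where
    r c c′ : ℕ
    r = rowOf T x
    c = colOf T x
    c′ = colOf T (g x)
    antitone : ∀ {r₁ r₂} → r₁ ≤ r₂ → rowLen λ′ r₂ ≤ rowLen λ′ r₁
    antitone = rowLen-antitone (Partition.decreasing part)

    above : (i : Fin (suc r)) → ∃ λ e → pos e ≡ (toℕ i , c)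
    above i = onto (toℕ i , c) (ℕP.<-≤-trans (inDiag x) (antitone (ℕP.≤-pred (FinP.toℕ<n i))))

    E : Fin (suc r) → Fin n
    E i = proj₁ (above i)

    gE-column : ∀ i → colOf T (g (E i)) ≡ c′
    gE-column i = g-respects-columns (cong proj₂ (proj₂ (above i)))

    gE-above : ∀ i → rowOf T (g (E i)) < r
    gE-above i = ℕP.≰⇒> λ r≤ → outside (ℕP.<-≤-trans
      (subst (_< rowLen λ′ (rowOf T (g (E i)))) (gE-column i) (inDiag (g (E i)))) (antitone r≤))

    squeeze : Fin (suc r) → Fin r
    squeeze i = Fin.fromℕ< (gE-above i)

    squeeze-injective : ∀ {i j} → squeeze i ≡ squeeze j → i ≡ j
    squeeze-injective {i} {j} eq = FinP.toℕ-injective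
      (trans (sym (cong proj₁ (proj₂ (above i)))) (trans (cong (rowOf T) Ei≡Ej) (cong proj₁ (proj₂ (above j)))))
      where
      same-row : rowOf T (g (E i)) ≡ rowOf T (g (E j))
      same-row = trans (sym (FinP.toℕ-fromℕ< (gE-above i))) (trans (cong toℕ eq) (FinP.toℕ-fromℕ< (gE-above j)))
      Ei≡Ej : E i ≡ E j
      Ei≡Ej = g-perm (sameBox⇒≡ T same-row (trans (gE-column i) (sym (gE-column j))))

  η : Fin n → Fin n
  η = eta T g

  pos-η : ∀ x → pos (η x) ≡ (rowOf T x , colOf T (g x))
  pos-η x = pos-entryAt T x _ (g-target-in-diagram x)

  η-row : R.Preserves η
  η-row x = cong proj₁ (pos-η x)

  η-col : ∀ x → colOf T (η x) ≡ colOf T (g x)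
  η-col x = cong proj₂ (pos-η x)

  η-respects-columns : ∀ {x y} → colOf T x ≡ colOf T y → colOf T (η x) ≡ colOf T (η y)
  η-respects-columns x|y = trans (η-col _) (trans (g-respects-columns x|y) (sym (η-col _)))

  η-reflects-columns : ∀ {x y} → colOf T (η x) ≡ colOf T (η y) → colOf T x ≡ colOf T y
  η-reflects-columns ηx|ηy = g-reflects-columns (trans (sym (η-col _)) (trans ηx|ηy (η-col _)))

  η-perm : IsPerm η
  η-perm {x} {y} ηx≡ηy = sameBox⇒≡ T
    (trans (sym (η-row x)) (trans (cong (rowOf T) ηx≡ηy) (η-row y)))
    (η-reflects-columns (cong (colOf T) ηx≡ηy))

  c : Fin n → Fin n
  c = invComp η g

  η∘c≗g : ∀ e → η (c e) ≡ g e
  η∘c≗g e = invComp-correct η g e (isPerm⇒surjective η-perm (g e))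

  c-col : C.Preserves c
  c-col e = g-reflects-columns (trans (sym (η-col (c e))) (cong (colOf T) (η∘c≗g e)))

  c-perm : IsPerm c
  c-perm {e} {e′} ce≡ce′ = g-perm (trans (sym (η∘c≗g e)) (trans (cong η ce≡ce′) (η∘c≗g e′)))

  inStab-conjugation : ∀ {π} → IsPerm π → C.inStab (PermBijection.to (conjugation η-perm) π) ≡ C.inStab π
  inStab-conjugation {π} _ = C.inStab-≡
    (λ pres x → η-reflects-columns
      (trans (cong (colOf T ∘ η ∘ π) (sym (inv-inverseˡ η-perm x))) (pres (η x))))
    (λ pres x → trans (η-respects-columns (pres (inv η x))) (cong (colOf T) (inv-inverseʳ η-perm x)))

if-then-0-*ˡ : ∀ b (x y : ℚ) → (if b then x * y else 0ℚ) ≡ x * (if b then y else 0ℚ)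
if-then-0-*ˡ true  x y = refl
if-then-0-*ˡ false x y = sym (ℚP.*-zeroʳ x)

module Equivariance {n λ′} (part : Partition n λ′) (T S : Filling n λ′) {g} (g∈C̃ : InCtilde T g)
                    (m : Monomial n) where
  open HigherSpecht T S
  open ColumnPermuting part T g∈C̃ using (η; η-perm; η-row; c; c-perm; c-col; η∘c≗g; g-perm; inStab-conjugation)

  conj : (Fin n → Fin n) → Fin n → Fin n
  conj = PermBijection.to (conjugation η-perm)

  coefficient : (Fin n → Fin n) → ℚ
  coefficient σ = hits σ m (weight σ)

  coefficient-cong : Respects≗ coefficient
  coefficient-cong {σ} {σ′} σ≗σ′ = Σℚ.∑-cong R.stab λ τ _ → cong₂ (λ v z → if does (v ≟ₘ m) then z else 0ℚ)
    (actMon-cong (λ i → σ≗σ′ (τ i)) p) (weight-cong σ≗σ′)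

  twisted : (Fin n → Fin n) → ℚ
  twisted σ = Σℚ.∑ R.stab (λ τ → if does (actMon (η ∘ₚ (σ ∘ₚ τ)) p ≟ₘ m) then weight σ else 0ℚ)

  twisted-cong : Respects≗ twisted
  twisted-cong {σ} {σ′} σ≗σ′ = Σℚ.∑-cong R.stab λ τ _ → cong₂ (λ v z → if does (v ≟ₘ m) then z else 0ℚ)
    (actMon-cong (λ i → cong η (σ≗σ′ (τ i))) p) (weight-cong σ≗σ′)

  -- g σ τ = η (c σ) τ, and c ∈ C(T) is absorbed by reindexing the sum over C(T)
  coeff-actPoly≡twisted : coeff (actPoly g (FTS T S)) m ≡ sgn c * Σℚ.∑ C.stab twisted
  coeff-actPoly≡twisted = begin
    coeff (actPoly g (FTS T S)) m
      ≡⟨ trans (∑-map (FTS T S) _ _) (∑-FTS _) ⟩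
    ∑ C.stab (λ σ → ∑ R.stab (λ τ → if does (actMon g (actMon (σ ∘ₚ τ) p) ≟ₘ m) then weight σ else 0ℚ))
      ≡⟨ ∑-cong C.stab (λ σ σ∈ → trans (∑-cong R.stab (pointwise σ∈)) (∑-*ˡ R.stab (sgn c) _)) ⟩
    ∑ C.stab (λ σ → sgn c * twisted (c ∘ₚ σ))
      ≡⟨ ∑-*ˡ C.stab (sgn c) _ ⟩
    sgn c * ∑ C.stab (λ σ → twisted (c ∘ₚ σ))
      ≡⟨ cong (sgn c *_) (C.∑-stab-leftMul c-perm c-col twisted twisted-cong) ⟩
    sgn c * ∑ C.stab twisted
      ∎
    where
    open ≡-Reasoning
    open Σℚ
    pointwise : ∀ {σ} → σ ∈ C.stab → ∀ τ → τ ∈ R.stab →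
      (if does (actMon g (actMon (σ ∘ₚ τ) p) ≟ₘ m) then weight σ else 0ℚ) ≡
      sgn c * (if does (actMon (η ∘ₚ ((c ∘ₚ σ) ∘ₚ τ)) p ≟ₘ m) then weight (c ∘ₚ σ) else 0ℚ)
    pointwise {σ} σ∈ τ τ∈ = trans
      (cong₂ (λ v z → if does (v ≟ₘ m) then z else 0ℚ) gστp≡ (weight-leftMul c-perm σ-perm))
      (if-then-0-*ˡ _ (sgn c) _)
      where
      σ-perm : IsPerm σ
      σ-perm = C.∈-stab⇒isPerm σ∈
      gστp≡ : actMon g (actMon (σ ∘ₚ τ) p) ≡ actMon (η ∘ₚ ((c ∘ₚ σ) ∘ₚ τ)) p
      gστp≡ = trans (sym (actMon-∘ g-perm (∘ₚ-isPerm σ-perm (R.∈-stab⇒isPerm τ∈)) p))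
                    (actMon-cong (λ i → sym (η∘c≗g (σ (τ i)))) p)

  coefficient∘conj≡twisted : ∀ σ → σ ∈ C.stab → coefficient (conj σ) ≡ twisted σ
  coefficient∘conj≡twisted σ σ∈ = begin
    ∑ R.stab hit                     ≡⟨ R.∑-stab-leftMul η-perm η-row hit hit-cong ⟨
    ∑ R.stab (λ τ → hit (η ∘ₚ τ))    ≡⟨ ∑-cong R.stab (λ τ _ → cong₂ (λ v z → if does (v ≟ₘ m) then z else 0ℚ)
                                          (actMon-cong (λ i → cong (η ∘ σ) (inv-inverseˡ η-perm (τ i))) p)
                                          weight-conj) ⟩
    twisted σ                        ∎
    where
    open ≡-Reasoning
    open Σℚ
    weight-conj : weight (conj σ) ≡ weight σ
    weight-conj = cong (λ z → divℚ (z * 1ℚ) s) (sgn-conjugate η-perm (C.∈-stab⇒isPerm σ∈))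

    hit : (Fin n → Fin n) → ℚ
    hit τ = if does (actMon (conj σ ∘ₚ τ) p ≟ₘ m) then weight (conj σ) else 0ℚ
    hit-cong : Respects≗ hit
    hit-cong τ≗τ′ = cong (λ v → if does (v ≟ₘ m) then weight (conj σ) else 0ℚ)
                         (actMon-cong (λ i → cong (conj σ) (τ≗τ′ i)) p)

  ∑-twisted : Σℚ.∑ C.stab twisted ≡ coeff (FTS T S) m
  ∑-twisted = begin
    ∑ C.stab twisted
      ≡⟨ ∑-cong C.stab coefficient∘conj≡twisted ⟨
    ∑ C.stab (coefficient ∘ conj)
      ≡⟨ C.∑-stab-reindex (conjugation η-perm) inStab-conjugation coefficient coefficient-cong ⟩
    ∑ C.stab coefficient
      ≡⟨ coeff-FTS m ⟨
    coeff (FTS T S) m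
      ∎
    where
    open ≡-Reasoning
    open Σℚ

  coeff-actPoly : coeff (actPoly g (FTS T S)) m ≡ sgnTilde T g * coeff (FTS T S) m
  coeff-actPoly = trans coeff-actPoly≡twisted (cong (sgn c *_) ∑-twisted)

proposition2p6 : (n : ℕ) (λ′ : List ℕ) → Partition n λ′ →
    (S : Filling n λ′) → IsStandard S → (T : Filling n λ′) →
    (∀ m → ∃ λ (z : ℤ) → coeff (FTS T S) m ≡ z / 1) ×
    (∀ m → coeff (FTS T S) m ≢ 0ℚ → degree m ≡ cc S) ×
    (coeff (FTS T S) (pTS T S) ≡ 1ℚ) ×
    (∀ (g : Fin n → Fin n) → InCtilde T g →
    ∀ m → coeff (actPoly g (FTS T S)) m ≡ sgnTilde T g * coeff (FTS T S) m)
proposition2p6 n λ′ part S std T =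
  HigherSpecht.coeff-integral T S ,
  HigherSpecht.coeff-homogeneous T S ,
  LeadingCoefficient.coeff-leading T S std ,
  λ g g∈C̃ m → Equivariance.coeff-actPoly part T S g∈C̃ m
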